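{- Let $\mathbb{k}$ be a field of characteristic zero, $A$ a commutative unital $\mathbb{k}$-algebra and $B$ a commutative unital $\mathbb{k}$-algebra which is an integral domain, and let $f : A \to B$ be $\mathbb{k}$-linear. If $\Phi_{n+1}(f) \equiv 0$ but $\Phi_n(f) \not\equiv 0$, then $f(1) = n\cdot 1_B$.
   Context: For a $\mathbb{k}$-linear map $f : A \to B$ and $m \ge 1$, define $\Phi_m(f)(a_1,\dots,a_m) = \sum_{\sigma \in \Sigma_m} \epsilon(\sigma) f_\sigma(a_1,\dots,a_m)$, where $\epsilon(\sigma)$ is the sign, and if $\sigma = \gamma_1\cdots\gamma_q$ is the disjoint cycle decomposition (including cycles of length one) then $f_\sigma = \prod_j f_{\gamma_j}$ with $f_\gamma(a_1,\dots,a_m) = f(a_{r_1}\cdots a_{r_j})$ for $\gamma = (r_1\,\dots\,r_j)$. $\Phi_m(f)\equiv 0$ means $\Phi_m(f)$ vanishes identically; $n\ge 1$. -}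

module Defs where

open import Level using (Level; _⊔_)
open import Data.Nat as ℕ using (ℕ; zero; suc)
open import Data.Bool using (Bool; true; false; not; _∧_; if_then_else_)
open import Data.Fin as Fin using (Fin; toℕ)
open import Data.Fin.Properties using () renaming (_≟_ to _≟ᶠ_)
open import Data.List as List using (List; []; _∷_; allFin; filterᵇ; concatMap; foldr)
open import Data.Bool.ListAction using (any; all)
open import Data.Vec as Vec using (Vec; lookup)
open import Data.Product using (Σ; _×_; _,_)
open import Data.Sum using (_⊎_)
open import Relation.Nullary using (¬_; does)
open import Algebra.Bundles using (CommutativeRing)
open import Algebra.Morphism.Structures using (IsRingHomomorphism)
import Algebra.Definitions.RawMonoid as RawMonoidDefs

private variable c ℓ c₁ ℓ₁ c₂ ℓ₂ : Level

infixr 8 _·_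
_·_ : {R : CommutativeRing c ℓ} → ℕ → CommutativeRing.Carrier R → CommutativeRing.Carrier R
_·_ {R = R} n x = RawMonoidDefs._×_ (CommutativeRing.+-rawMonoid R) n x

record IsField (K : CommutativeRing c ℓ) : Set (c ⊔ ℓ) where
  open CommutativeRing K
  field
    1≉0 : ¬ (1# ≈ 0#)
    inverse : ∀ x → ¬ (x ≈ 0#) → Σ Carrier λ y → x * y ≈ 1#

CharZero : CommutativeRing c ℓ → Set ℓ
CharZero K = ∀ n → ¬ (_·_ {R = K} (suc n) 1# ≈ 0#)
  where open CommutativeRing K

record IsIntegralDomain (R : CommutativeRing c ℓ) : Set (c ⊔ ℓ) where
  open CommutativeRing R
  field
    1≉0 : ¬ (1# ≈ 0#)
    noZeroDivisors : ∀ x y → x * y ≈ 0# → (x ≈ 0#) ⊎ (y ≈ 0#)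

-- A commutative unital 𝕜-algebra is a commutative ring A together with a
-- unital ring homomorphism ι : 𝕜 → A (scalar multiplication c·a = ι c * a).
IsAlgebraMap : (K : CommutativeRing c₁ ℓ₁) (A : CommutativeRing c₂ ℓ₂) →
               (CommutativeRing.Carrier K → CommutativeRing.Carrier A) → Set _
IsAlgebraMap K A ι = IsRingHomomorphism (CommutativeRing.rawRing K) (CommutativeRing.rawRing A) ι

record IsLinear (K : CommutativeRing c ℓ) (A : CommutativeRing c₁ ℓ₁) (B : CommutativeRing c₂ ℓ₂)
                (ιA : CommutativeRing.Carrier K → CommutativeRing.Carrier A)
                (ιB : CommutativeRing.Carrier K → CommutativeRing.Carrier B)
                (f : CommutativeRing.Carrier A → CommutativeRing.Carrier B) : Set (c ⊔ c₁ ⊔ ℓ₁ ⊔ ℓ₂) where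
  private
    module A = CommutativeRing A
    module B = CommutativeRing B
  field
    cong  : ∀ {x y} → x A.≈ y → f x B.≈ f y
    additive : ∀ x y → f (x A.+ y) B.≈ f x B.+ f y
    homogeneous : ∀ (k : CommutativeRing.Carrier K) x → f (ιA k A.* x) B.≈ ιB k B.* f x

allVecs : (m n : ℕ) → List (Vec (Fin m) n)
allVecs m zero = Vec.[] ∷ []
allVecs m (suc n) = concatMap (λ v → List.map (λ i → i Vec.∷ v) (allFin m)) (allVecs m n)

eqᵇ : ∀ {m} → Fin m → Fin m → Bool
eqᵇ i j = does (i ≟ᶠ j)

noDup : ∀ {m} → List (Fin m) → Bool
noDup [] = true
noDup (x ∷ xs) = not (any (eqᵇ x) xs) ∧ noDup xs

-- Σ_m : the list of all permutations of Fin m, each exactly once,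
-- represented as their table of values σ = (σ 0, …, σ (m-1))
perms : (m : ℕ) → List (Vec (Fin m) m)
perms m = filterᵇ (λ v → noDup (Vec.toList v)) (allVecs m m)

ltᵇ : ∀ {m} → Fin m → Fin m → Bool
ltᵇ i j = does (toℕ i ℕ.<? toℕ j)

leᵇ : ∀ {m} → Fin m → Fin m → Bool
leᵇ i j = does (toℕ i ℕ.≤? toℕ j)

inversions : ∀ {m} → Vec (Fin m) m → ℕ
inversions {m} σ = List.length
  (filterᵇ (λ p → ltᵇ (Data.Product.proj₁ p) (Data.Product.proj₂ p) ∧
                  ltᵇ (lookup σ (Data.Product.proj₂ p)) (lookup σ (Data.Product.proj₁ p)))
           (List.cartesianProduct (allFin m) (allFin m)))
  where import Data.Product

-- sign ε(σ) = (-1)^(number of inversions); true = +1, false = -1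
isEven : ℕ → Bool
isEven zero = true
isEven (suc n) = not (isEven n)

iter : ∀ {m} → Vec (Fin m) m → ℕ → Fin m → Fin m
iter σ zero i = i
iter σ (suc k) i = lookup σ (iter σ k i)

-- length of the cycle of σ through i: least k ∈ {1,…,m} with σ^k i = i
-- (exists since σ is a permutation of Fin m)
cycleLen : ∀ {m} → Vec (Fin m) m → Fin m → ℕ
cycleLen {m} σ i = go 1 m
  where
  go : ℕ → ℕ → ℕ
  go k zero = k
  go k (suc fuel) = if eqᵇ (iter σ k i) i then k else go (suc k) fuel

cycleOf : ∀ {m} → Vec (Fin m) m → Fin m → List (Fin m)
cycleOf σ i = List.map (λ k → iter σ k i) (List.upTo (cycleLen σ i))

-- i is the representative (least element) of its cycle
isLeader : ∀ {m} → Vec (Fin m) m → Fin m → Bool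
isLeader σ i = all (leᵇ i) (cycleOf σ i)

-- the disjoint cycles of σ (including cycles of length one), one per cycle
cycles : ∀ {m} → Vec (Fin m) m → List (List (Fin m))
cycles {m} σ = List.map (cycleOf σ) (filterᵇ (isLeader σ) (allFin m))

module _ (A : CommutativeRing c₁ ℓ₁) (B : CommutativeRing c₂ ℓ₂) where
  private
    module A = CommutativeRing A
    module B = CommutativeRing B

  fCycle : (A.Carrier → B.Carrier) → ∀ {m} → List (Fin m) → (Fin m → A.Carrier) → B.Carrier
  fCycle f γ a = f (foldr (λ r x → a r A.* x) A.1# γ)

  fPerm : (A.Carrier → B.Carrier) → ∀ {m} → Vec (Fin m) m → (Fin m → A.Carrier) → B.Carrier
  fPerm f σ a = foldr (λ γ y → fCycle f γ a B.* y) B.1# (cycles σ)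

  signed : ∀ {m} → Vec (Fin m) m → B.Carrier → B.Carrier
  signed σ x = if isEven (inversions σ) then x else B.- x

  Φ : (m : ℕ) → (A.Carrier → B.Carrier) → (Fin m → A.Carrier) → B.Carrier
  Φ m f a = foldr (λ σ y → signed σ (fPerm f σ a) B.+ y) B.0# (perms m)

  VanishesΦ : ℕ → (A.Carrier → B.Carrier) → Set (c₁ ⊔ ℓ₂)
  VanishesΦ m f = ∀ (a : Fin m → A.Carrier) → Φ m f a B.≈ B.0#

module Submission where

-- Every permutation of {0, …, m} arises exactly once from a permutation σ of {1, …, m} by
-- adjoining 0: either as a new fixed point, or inserted into a cycle of σ right after one of
-- its m points. Taking a₀ = 1, the fixed point contributes ε(σ) f(1) f_σ(a), while each
-- insertion flips the sign and leaves every cycle product unchanged, contributing −ε(σ) f_σ(a).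
-- Hence Φ_{m+1}(f)(1, a) = (f(1) − m) Φ_m(f)(a), and so Φ_{n+1}(f)(1, …, 1) = ∏_{k ≤ n} (f(1) − k).
-- If Φ_{n+1}(f) ≡ 0, the integral domain B forces f(1) = k for some k ≤ n. Were k < n, then
-- f(1) − n = k − n ≠ 0 (characteristic zero passes from 𝕜 to B through the unit map), and the
-- recursion would make Φ_n(f) vanish identically. Going through the root k, rather than
-- refuting f(1) ≠ n, keeps the argument constructive.

open import Defs
open import Level using (Level)
open import Data.Nat using (ℕ; zero; suc; _<_; _≤_; _≥_; z≤n; s≤s)
import Data.Nat as Nat
import Data.Nat.Properties as ℕP
open import Data.Nat.DivMod using (_%_; _/_; m≡m%n+[m/n]*n; m%n<n)
open import Data.Bool using (Bool; true; false; not; _∧_; _xor_; if_then_else_; T)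
open import Data.Bool.Properties using (∨-zeroʳ; ¬-not; ⇔→≡; xor-∧-commutativeRing; xor-identityʳ; ∧-zeroʳ; ∧-identityʳ)
open import Data.Bool.ListAction using (any; all)
open import Data.Fin as Fin using (Fin; zero; suc; toℕ; punchOut)
open import Data.Fin.Properties as FinP using (punchOut-injective; pigeonhole; any?; suc-injective; toℕ<n; toℕ-injective)
open import Data.Vec as Vec using (Vec; []; _∷_; lookup; tabulate)
open import Data.Vec.Properties using (lookup∘tabulate; tabulate∘lookup; tabulate-cong)
open import Data.Vec.Functional using () renaming (_∷_ to _∷ᶠ_)
open import Data.List as List using (List; []; _∷_; _++_; map; concatMap; filterᵇ; allFin; applyUpTo; upTo; length; cartesianProduct)
open import Data.List.Properties using (map-tabulate; map-upTo; map-applyUpTo)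
open import Data.Product using (Σ; _×_; _,_; proj₂)
open import Data.Sum using (inj₁; inj₂; [_,_]′)
open import Data.Empty using (⊥; ⊥-elim)
open import Relation.Nullary using (¬_; yes; no)
open import Relation.Nullary.Decidable using (dec-true; dec-false)
open import Relation.Binary.Definitions using (tri<; tri≈; tri>)
open import Relation.Binary.PropositionalEquality as ≡ using (_≡_; _≢_)
import Relation.Binary.Reasoning.Setoid as SetoidReasoning
open import Function using (_∘_; _∘′_; id)
open import Function.Bundles using (mk⇔)
open import Algebra.Bundles using (CommutativeMonoid; CommutativeRing)
open import Algebra.Morphism.Structures using (IsRingHomomorphism)
import Algebra.Properties.CommutativeSemigroup as CommutativeSemigroupProperties
import Algebra.Properties.Group as GroupProperties
import Algebra.Properties.Monoid.Mult as MultProperties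
import Algebra.Properties.Ring as RingProperties

_≡ᵇᵛ_ : ∀ {m n} → Vec (Fin m) n → Vec (Fin m) n → Bool
[] ≡ᵇᵛ [] = true
(x ∷ xs) ≡ᵇᵛ (y ∷ ys) = eqᵇ x y ∧ (xs ≡ᵇᵛ ys)

private variable
  a b : Level
  X : Set a
  Y : Set b

module BigSum {c ℓ} (M : CommutativeMonoid c ℓ) where
  open CommutativeMonoid M renaming (Carrier to C)
  open Nat using (_+_)
  open CommutativeSemigroupProperties commutativeSemigroup using (interchange)
  open SetoidReasoning setoid

  ∑ : (X → C) → List X → C
  ∑ h = List.foldr (λ x y → h x ∙ y) ε

  ∑ᶠ : ∀ {n} → (Fin n → C) → C
  ∑ᶠ {n} h = ∑ h (allFin n)

  ∑< : (ℕ → C) → ℕ → C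
  ∑< h n = ∑ h (upTo n)

  indicator : ∀ {n} → Fin n → C → Fin n → C
  indicator x d u = if eqᵇ u x then d else ε

  ∑-cong : ∀ {h g : X → C} xs → (∀ x → h x ≈ g x) → ∑ h xs ≈ ∑ g xs
  ∑-cong [] e = refl
  ∑-cong (x ∷ xs) e = ∙-cong (e x) (∑-cong xs e)

  ∑-ε : ∀ (xs : List X) → ∑ (λ _ → ε) xs ≈ ε
  ∑-ε [] = refl
  ∑-ε (x ∷ xs) = trans (identityˡ _) (∑-ε xs)

  ∑-zero : ∀ {h : X → C} xs → (∀ x → h x ≈ ε) → ∑ h xs ≈ ε
  ∑-zero xs e = trans (∑-cong xs e) (∑-ε xs)

  ∑-++ : ∀ (h : X → C) xs ys → ∑ h (xs ++ ys) ≈ ∑ h xs ∙ ∑ h ys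
  ∑-++ h [] ys = sym (identityˡ _)
  ∑-++ h (x ∷ xs) ys = trans (∙-cong refl (∑-++ h xs ys)) (sym (assoc _ _ _))

  ∑-filterᵇ : ∀ (h : X → C) (p : X → Bool) xs → ∑ h (filterᵇ p xs) ≈ ∑ (λ x → if p x then h x else ε) xs
  ∑-filterᵇ h p [] = refl
  ∑-filterᵇ h p (x ∷ xs) with p x
  ... | true = ∙-cong refl (∑-filterᵇ h p xs)
  ... | false = trans (∑-filterᵇ h p xs) (sym (identityˡ _))

  ∑-filterᵇ-cong : ∀ (p : X → Bool) {h g : X → C} xs → (∀ x → p x ≡ true → h x ≈ g x) →
                   ∑ h (filterᵇ p xs) ≈ ∑ g (filterᵇ p xs)
  ∑-filterᵇ-cong p [] e = refl
  ∑-filterᵇ-cong p (x ∷ xs) e with p x in px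
  ... | true = ∙-cong (e x px) (∑-filterᵇ-cong p xs e)
  ... | false = ∑-filterᵇ-cong p xs e

  ∑-∙ : ∀ (h g : X → C) xs → ∑ (λ x → h x ∙ g x) xs ≈ ∑ h xs ∙ ∑ g xs
  ∑-∙ h g [] = sym (identityˡ _)
  ∑-∙ h g (x ∷ xs) = trans (∙-cong refl (∑-∙ h g xs)) (interchange _ _ _ _)

  ∑-if : ∀ (b : Bool) (h : X → C) xs → ∑ (λ x → if b then h x else ε) xs ≈ (if b then ∑ h xs else ε)
  ∑-if true h xs = refl
  ∑-if false h xs = ∑-ε xs

  ∑-map : ∀ (h : Y → C) (g : X → Y) xs → ∑ h (map g xs) ≡ ∑ (h ∘ g) xs
  ∑-map h g [] = ≡.refl
  ∑-map h g (x ∷ xs) = ≡.cong (h (g x) ∙_) (∑-map h g xs)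

  ∑-concatMap : ∀ (h : Y → C) (k : X → List Y) xs → ∑ h (concatMap k xs) ≈ ∑ (λ x → ∑ h (k x)) xs
  ∑-concatMap h k [] = refl
  ∑-concatMap h k (x ∷ xs) = trans (∑-++ h (k x) (concatMap k xs)) (∙-cong refl (∑-concatMap h k xs))

  ∑-swap : ∀ (h : X → Y → C) xs ys → ∑ (λ x → ∑ (h x) ys) xs ≈ ∑ (λ y → ∑ (λ x → h x y) xs) ys
  ∑-swap h [] ys = sym (∑-ε ys)
  ∑-swap h (x ∷ xs) ys = begin
    ∑ (h x) ys ∙ ∑ (λ x → ∑ (h x) ys) xs           ≈⟨ ∙-cong refl (∑-swap h xs ys) ⟩
    ∑ (h x) ys ∙ ∑ (λ y → ∑ (λ x → h x y) xs) ys   ≈⟨ sym (∑-∙ (h x) _ ys) ⟩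
    ∑ (λ y → h x y ∙ ∑ (λ x → h x y) xs) ys        ∎

  ∑ᶠ-suc : ∀ {n} (h : Fin (suc n) → C) → ∑ᶠ h ≡ h Fin.zero ∙ ∑ᶠ (h ∘ Fin.suc)
  ∑ᶠ-suc {n} h = ≡.cong (h Fin.zero ∙_)
    (≡.trans (≡.cong (∑ h) (≡.sym (map-tabulate id Fin.suc))) (∑-map h Fin.suc (allFin n)))

  ∑ᶠ-cong : ∀ {n} {h g : Fin n → C} → (∀ x → h x ≈ g x) → ∑ᶠ h ≈ ∑ᶠ g
  ∑ᶠ-cong {n} = ∑-cong (allFin n)

  ∑ᶠ-indicator : ∀ {n} (x : Fin n) (d : C) → ∑ᶠ (indicator x d) ≈ d
  ∑ᶠ-indicator {suc n} Fin.zero d = begin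
    ∑ᶠ (indicator {suc n} Fin.zero d) ≡⟨ ∑ᶠ-suc (indicator {suc n} Fin.zero d) ⟩
    d ∙ ∑ᶠ {n} (λ _ → ε)              ≈⟨ ∙-cong refl (∑-ε (allFin n)) ⟩
    d ∙ ε                             ≈⟨ identityʳ d ⟩
    d                                 ∎
  ∑ᶠ-indicator {suc n} (Fin.suc x) d = begin
    ∑ᶠ (indicator (Fin.suc x) d)   ≡⟨ ∑ᶠ-suc (indicator (Fin.suc x) d) ⟩
    ε ∙ ∑ᶠ (indicator x d)         ≈⟨ identityˡ _ ⟩
    ∑ᶠ (indicator x d)             ≈⟨ ∑ᶠ-indicator x d ⟩
    d                              ∎

  ∑ᶠ-single : ∀ {n} {h : Fin n → C} l → (∀ i → i ≢ l → h i ≈ ε) → ∑ᶠ h ≈ h l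
  ∑ᶠ-single {h = h} l others = trans (∑ᶠ-cong at) (∑ᶠ-indicator l (h l))
    where
    at : ∀ i → h i ≈ indicator l (h l) i
    at i with i Fin.≟ l
    ... | yes ≡.refl = refl
    ... | no i≢l = others i i≢l

  if-ε-split : ∀ b x → x ≈ (if b then x else ε) ∙ (if b then ε else x)
  if-ε-split true x = sym (identityʳ x)
  if-ε-split false x = sym (identityˡ x)

  ∑-allVecs-indicator : ∀ {m n} (v : Vec (Fin m) n) (d : C) →
                        ∑ (λ u → if u ≡ᵇᵛ v then d else ε) (allVecs m n) ≈ d
  ∑-allVecs-indicator {m} {zero} Vec.[] d = identityʳ d
  ∑-allVecs-indicator {m} {suc n} (j Vec.∷ v) d = begin
    ∑ h (allVecs m (suc n))                                ≈⟨ ∑-concatMap h (λ w → map (Vec._∷ w) (allFin m)) (allVecs m n) ⟩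
    ∑ (λ w → ∑ h (map (Vec._∷ w) (allFin m))) (allVecs m n) ≈⟨ ∑-cong (allVecs m n) (λ w → reflexive (∑-map h (Vec._∷ w) (allFin m))) ⟩
    ∑ (λ w → ∑ᶠ (λ i → h (i Vec.∷ w))) (allVecs m n)       ≈⟨ ∑-cong (allVecs m n) (λ w → trans (∑ᶠ-cong (head-split w)) (∑ᶠ-indicator j _)) ⟩
    ∑ (λ w → if w ≡ᵇᵛ v then d else ε) (allVecs m n)       ≈⟨ ∑-allVecs-indicator v d ⟩
    d                                                      ∎
    where
    h : Vec (Fin m) (suc n) → C
    h u = if u ≡ᵇᵛ (j Vec.∷ v) then d else ε
    head-split : ∀ w i → h (i Vec.∷ w) ≈ indicator j (if w ≡ᵇᵛ v then d else ε) i
    head-split w i with eqᵇ i j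
    ... | true = refl
    ... | false = refl

  ∑-applyUpTo : ∀ (h : X → C) (g : ℕ → X) n → ∑ h (applyUpTo g n) ≡ ∑< (h ∘ g) n
  ∑-applyUpTo h g n = ≡.trans (≡.cong (∑ h) (≡.sym (map-upTo g n))) (∑-map h g (upTo n))

  ∑<-suc : ∀ h n → ∑< h (suc n) ≡ h 0 ∙ ∑< (h ∘ suc) n
  ∑<-suc h n = ≡.cong (h 0 ∙_) (∑-applyUpTo h suc n)

  ∑<-snoc : ∀ h n → ∑< h (suc n) ≈ ∑< h n ∙ h n
  ∑<-snoc h zero = comm _ _
  ∑<-snoc h (suc n) = begin
    ∑< h (suc (suc n))                 ≡⟨ ∑<-suc h (suc n) ⟩
    h 0 ∙ ∑< (h ∘ suc) (suc n)         ≈⟨ ∙-cong refl (∑<-snoc (h ∘ suc) n) ⟩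
    h 0 ∙ (∑< (h ∘ suc) n ∙ h (suc n)) ≈⟨ sym (assoc _ _ _) ⟩
    (h 0 ∙ ∑< (h ∘ suc) n) ∙ h (suc n) ≡⟨ ≡.cong (_∙ h (suc n)) (≡.sym (∑<-suc h n)) ⟩
    ∑< h (suc n) ∙ h (suc n)           ∎

  ∑<-cong : ∀ {h g} n → (∀ j → j < n → h j ≈ g j) → ∑< h n ≈ ∑< g n
  ∑<-cong zero e = refl
  ∑<-cong {h} {g} (suc n) e = begin
    ∑< h (suc n)           ≡⟨ ∑<-suc h n ⟩
    h 0 ∙ ∑< (h ∘ suc) n   ≈⟨ ∙-cong (e 0 (s≤s z≤n)) (∑<-cong n (λ j j<n → e (suc j) (s≤s j<n))) ⟩
    g 0 ∙ ∑< (g ∘ suc) n   ≡⟨ ≡.sym (∑<-suc g n) ⟩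
    ∑< g (suc n)           ∎

  ∑<-rotate : ∀ h n → h n ≈ h 0 → ∑< (h ∘ suc) n ≈ ∑< h n
  ∑<-rotate h zero e = refl
  ∑<-rotate h (suc n) e = begin
    ∑< (h ∘ suc) (suc n)          ≈⟨ ∑<-snoc (h ∘ suc) n ⟩
    ∑< (h ∘ suc) n ∙ h (suc n)    ≈⟨ ∙-cong refl e ⟩
    ∑< (h ∘ suc) n ∙ h 0          ≈⟨ comm _ _ ⟩
    h 0 ∙ ∑< (h ∘ suc) n          ≡⟨ ≡.sym (∑<-suc h n) ⟩
    ∑< h (suc n)                  ∎

  ∑<-shift-periodic : ∀ h n → (∀ i → h (i + n) ≈ h i) → ∀ s → ∑< (λ i → h (i + s)) n ≈ ∑< h n
  ∑<-shift-periodic h n per zero = ∑<-cong n (λ j _ → reflexive (≡.cong h (ℕP.+-identityʳ j)))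
  ∑<-shift-periodic h n per (suc s) = begin
    ∑< (λ i → h (i + suc s)) n ≈⟨ ∑<-cong n (λ j _ → reflexive (≡.cong h (ℕP.+-suc j s))) ⟩
    ∑< (h′ ∘ suc) n            ≈⟨ ∑<-rotate h′ n (trans (reflexive (≡.cong h (ℕP.+-comm n s))) (per s)) ⟩
    ∑< h′ n                    ≈⟨ ∑<-shift-periodic h n per s ⟩
    ∑< h n                     ∎
    where
    h′ : ℕ → C
    h′ i = h (i + s)

module Permutation where
  open ≡

  eqᵇ⇒≡ : ∀ {m} {x y : Fin m} → eqᵇ x y ≡ true → x ≡ y
  eqᵇ⇒≡ {x = x} {y} e with x Fin.≟ y
  ... | yes p = p
  eqᵇ⇒≡ () | no _

  eqᵇ-false⇒≢ : ∀ {m} {x y : Fin m} → eqᵇ x y ≡ false → x ≢ y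
  eqᵇ-false⇒≢ {x = x} {y} e with x Fin.≟ y
  eqᵇ-false⇒≢ () | yes _
  ... | no p = p

  eqᵇ-refl : ∀ {m} (x : Fin m) → eqᵇ x x ≡ true
  eqᵇ-refl x = dec-true (x Fin.≟ x) refl

  ≢⇒eqᵇ-false : ∀ {m} {x y : Fin m} → x ≢ y → eqᵇ x y ≡ false
  ≢⇒eqᵇ-false {x = x} {y} = dec-false (x Fin.≟ y)

  ≡ᵇᵛ⇒≡ : ∀ {m n} {u v : Vec (Fin m) n} → u ≡ᵇᵛ v ≡ true → u ≡ v
  ≡ᵇᵛ⇒≡ {u = []} {[]} e = refl
  ≡ᵇᵛ⇒≡ {u = x ∷ u} {y ∷ v} e with eqᵇ x y in exy
  ... | true = cong₂ _∷_ (eqᵇ⇒≡ exy) (≡ᵇᵛ⇒≡ e)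

  ≡ᵇᵛ-refl : ∀ {m n} (u : Vec (Fin m) n) → u ≡ᵇᵛ u ≡ true
  ≡ᵇᵛ-refl [] = refl
  ≡ᵇᵛ-refl (x ∷ u) rewrite eqᵇ-refl x = ≡ᵇᵛ-refl u

  lookup-extensional : ∀ {a} {A : Set a} {n} {u v : Vec A n} → (∀ i → lookup u i ≡ lookup v i) → u ≡ v
  lookup-extensional {u = u} {v} p = trans (sym (tabulate∘lookup u)) (trans (tabulate-cong p) (tabulate∘lookup v))

  Injectiveᵛ : ∀ {m n} → Vec (Fin m) n → Set
  Injectiveᵛ v = ∀ i j → lookup v i ≡ lookup v j → i ≡ j

  isPermᵇ : ∀ {m n} → Vec (Fin m) n → Bool
  isPermᵇ v = noDup (Vec.toList v)

  any-eqᵇ⇒lookup : ∀ {m n} (x : Fin m) (w : Vec (Fin m) n) → any (eqᵇ x) (Vec.toList w) ≡ true →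
                   Σ (Fin n) λ i → lookup w i ≡ x
  any-eqᵇ⇒lookup x (y ∷ w) e with eqᵇ x y in exy
  ... | true = zero , sym (eqᵇ⇒≡ exy)
  ... | false with any-eqᵇ⇒lookup x w e
  ... | i , p = suc i , p

  lookup⇒any-eqᵇ : ∀ {m n} (x : Fin m) (w : Vec (Fin m) n) i → lookup w i ≡ x → any (eqᵇ x) (Vec.toList w) ≡ true
  lookup⇒any-eqᵇ x (y ∷ w) zero refl rewrite eqᵇ-refl y = refl
  lookup⇒any-eqᵇ x (y ∷ w) (suc i) p rewrite lookup⇒any-eqᵇ x w i p = ∨-zeroʳ _

  isPermᵇ⇒injective : ∀ {m n} (v : Vec (Fin m) n) → isPermᵇ v ≡ true → Injectiveᵛ v
  isPermᵇ⇒injective (x ∷ w) e zero zero p = refl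
  isPermᵇ⇒injective (x ∷ w) e zero (suc j) p with any (eqᵇ x) (Vec.toList w) in e1
  isPermᵇ⇒injective (x ∷ w) () zero (suc j) p | true
  ... | false with () ← trans (sym (lookup⇒any-eqᵇ x w j (sym p))) e1
  isPermᵇ⇒injective (x ∷ w) e (suc i) zero p with any (eqᵇ x) (Vec.toList w) in e1
  isPermᵇ⇒injective (x ∷ w) () (suc i) zero p | true
  ... | false with () ← trans (sym (lookup⇒any-eqᵇ x w i p)) e1
  isPermᵇ⇒injective (x ∷ w) e (suc i) (suc j) p with any (eqᵇ x) (Vec.toList w)
  isPermᵇ⇒injective (x ∷ w) () (suc i) (suc j) p | true
  ... | false = cong suc (isPermᵇ⇒injective w e i j p)

  injective⇒isPermᵇ : ∀ {m n} (v : Vec (Fin m) n) → Injectiveᵛ v → isPermᵇ v ≡ true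
  injective⇒isPermᵇ [] inj = refl
  injective⇒isPermᵇ (x ∷ w) inj with any (eqᵇ x) (Vec.toList w) in e1
  ... | true with i , p ← any-eqᵇ⇒lookup x w e1 with () ← inj zero (suc i) (sym p)
  ... | false = injective⇒isPermᵇ w (λ i j p → suc-injective (inj (suc i) (suc j) p))

  -- adjoinZero σ zero has 0 as a new fixed point; adjoinZero σ (suc s) inserts 0 into the cycle of s, right after s.
  adjoinZeroᶠ : ∀ {m} → Vec (Fin m) m → Fin (suc m) → Fin (suc m) → Fin (suc m)
  adjoinZeroᶠ σ zero    zero    = zero
  adjoinZeroᶠ σ zero    (suc i) = suc (lookup σ i)
  adjoinZeroᶠ σ (suc s) zero    = suc (lookup σ s)
  adjoinZeroᶠ σ (suc s) (suc i) = if eqᵇ i s then zero else suc (lookup σ i)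

  adjoinZero : ∀ {m} → Vec (Fin m) m → Fin (suc m) → Vec (Fin (suc m)) (suc m)
  adjoinZero σ t = tabulate (adjoinZeroᶠ σ t)

  adjoinZero-lookup : ∀ {m} (σ : Vec (Fin m) m) t k → lookup (adjoinZero σ t) k ≡ adjoinZeroᶠ σ t k
  adjoinZero-lookup σ t = lookup∘tabulate (adjoinZeroᶠ σ t)

  adjoinZeroᶠ-after : ∀ {m} (σ : Vec (Fin m) m) s → adjoinZeroᶠ σ (suc s) (suc s) ≡ zero
  adjoinZeroᶠ-after σ s rewrite eqᵇ-refl s = refl

  adjoinZeroᶠ-≢ : ∀ {m} (σ : Vec (Fin m) m) {s i} → i ≢ s → adjoinZeroᶠ σ (suc s) (suc i) ≡ suc (lookup σ i)
  adjoinZeroᶠ-≢ σ i≢s rewrite ≢⇒eqᵇ-false i≢s = refl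

  adjoinZero-injective : ∀ {m} (σ : Vec (Fin m) m) t → Injectiveᵛ σ → Injectiveᵛ (adjoinZero σ t)
  adjoinZero-injective σ t inj i j p =
    injectiveᶠ t i j (trans (sym (adjoinZero-lookup σ t i)) (trans p (adjoinZero-lookup σ t j)))
    where
    injectiveᶠ : ∀ t i j → adjoinZeroᶠ σ t i ≡ adjoinZeroᶠ σ t j → i ≡ j
    injectiveᶠ zero zero zero p = refl
    injectiveᶠ zero (suc i) (suc j) p = cong suc (inj i j (suc-injective p))
    injectiveᶠ (suc s) zero zero p = refl
    injectiveᶠ (suc s) zero (suc j) p with eqᵇ j s in e
    ... | false with () ← eqᵇ-false⇒≢ e (sym (inj s j (suc-injective p)))
    injectiveᶠ (suc s) (suc i) zero p with eqᵇ i s in e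
    ... | false with () ← eqᵇ-false⇒≢ e (inj i s (suc-injective p))
    injectiveᶠ (suc s) (suc i) (suc j) p with eqᵇ i s in ei | eqᵇ j s in ej
    ... | true  | true  = cong suc (trans (eqᵇ⇒≡ ei) (sym (eqᵇ⇒≡ ej)))
    ... | false | false = cong suc (inj i j (suc-injective p))

  adjoinZero-injective⁻ : ∀ {m} (σ : Vec (Fin m) m) t → Injectiveᵛ (adjoinZero σ t) → Injectiveᵛ σ
  adjoinZero-injective⁻ σ t inj i j p = reflectᶠ t (λ k l q → inj k l
    (trans (adjoinZero-lookup σ t k) (trans q (sym (adjoinZero-lookup σ t l)))))
    where
    reflectᶠ : ∀ t → (∀ k l → adjoinZeroᶠ σ t k ≡ adjoinZeroᶠ σ t l → k ≡ l) → i ≡ j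
    reflectᶠ zero injᶠ = suc-injective (injᶠ (suc i) (suc j) (cong suc p))
    reflectᶠ (suc s) injᶠ with i Fin.≟ s | j Fin.≟ s
    ... | yes refl | yes refl = refl
    ... | yes refl | no j≢s with () ← injᶠ zero (suc j) (trans (cong suc p) (sym (adjoinZeroᶠ-≢ σ j≢s)))
    ... | no i≢s | yes refl with () ← injᶠ (suc i) zero (trans (adjoinZeroᶠ-≢ σ i≢s) (cong suc p))
    ... | no i≢s | no j≢s = suc-injective (injᶠ (suc i) (suc j)
                              (trans (adjoinZeroᶠ-≢ σ i≢s) (trans (cong suc p) (sym (adjoinZeroᶠ-≢ σ j≢s)))))

  adjoinZero-cancel : ∀ {m} {σ σ′ : Vec (Fin m) m} {t t′} → adjoinZero σ t ≡ adjoinZero σ′ t′ → σ ≡ σ′ × t ≡ t′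
  adjoinZero-cancel {σ = σ} {σ′} {t} {t′} e = cancelᶠ t t′
    (λ k → trans (sym (adjoinZero-lookup σ t k)) (trans (cong (λ v → lookup v k) e) (adjoinZero-lookup σ′ t′ k)))
    where
    cancelᶠ : ∀ t t′ → (∀ k → adjoinZeroᶠ σ t k ≡ adjoinZeroᶠ σ′ t′ k) → σ ≡ σ′ × t ≡ t′
    cancelᶠ zero zero p = lookup-extensional (λ i → suc-injective (p (suc i))) , refl
    cancelᶠ zero (suc t′) p with () ← p zero
    cancelᶠ (suc t) zero p with () ← p zero
    cancelᶠ (suc s) (suc s′) p with s Fin.≟ s′
    ... | no s≢s′ with () ← trans (sym (adjoinZeroᶠ-after σ s)) (trans (p (suc s)) (adjoinZeroᶠ-≢ σ′ s≢s′))
    ... | yes refl = lookup-extensional agree , refl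
      where
      agree : ∀ i → lookup σ i ≡ lookup σ′ i
      agree i with i Fin.≟ s
      ... | yes refl = suc-injective (p zero)
      ... | no i≢s = suc-injective (trans (sym (adjoinZeroᶠ-≢ σ i≢s)) (trans (p (suc i)) (adjoinZeroᶠ-≢ σ′ i≢s)))

  preimage-zero : ∀ {m} (v : Vec (Fin (suc m)) (suc m)) → Injectiveᵛ v → Σ (Fin (suc m)) λ j → lookup v j ≡ zero
  preimage-zero {m} v inj with any? (λ j → lookup v j Fin.≟ zero)
  ... | yes p = p
  ... | no ∄ with i , j , i<j , e ← pigeonhole (ℕP.n<1+n m) (λ j → punchOut {i = zero} (λ eq → ∄ (j , sym eq)))
    = ⊥-elim (FinP.<-irrefl (inj i j (punchOut-injective {i = zero} _ _ e)) i<j)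

  -- predOr d x is x - 1, with the junk value d at x = 0.
  predOr : ∀ {m} → Fin m → Fin (suc m) → Fin m
  predOr d zero    = d
  predOr d (suc x) = x

  suc-predOr : ∀ {m} (d : Fin m) {x : Fin (suc m)} → x ≢ zero → suc (predOr d x) ≡ x
  suc-predOr d {zero} x≢0 = ⊥-elim (x≢0 refl)
  suc-predOr d {suc x} x≢0 = refl

  adjoinZero-surjective : ∀ {m} (v : Vec (Fin (suc m)) (suc m)) → Injectiveᵛ v →
                          Σ (Vec (Fin m) m) λ σ → Σ (Fin (suc m)) λ t → adjoinZero σ t ≡ v
  adjoinZero-surjective {m} v inj with t , Vt≡0 ← preimage-zero v inj =
    σ , t , lookup-extensional (λ k → trans (adjoinZero-lookup σ t k) (agree t Vt≡0 k))
    where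
    V = lookup v
    -- σ i = V (i + 1) − 1; at the preimage of 0 the junk value must be V 0 − 1.
    σ : Vec (Fin m) m
    σ = tabulate (λ i → predOr (predOr i (V zero)) (V (suc i)))
    nonzero : ∀ {t k} → V t ≡ zero → k ≢ t → V k ≢ zero
    nonzero {t} Vt≡0 k≢t Vk≡0 = k≢t (inj _ t (trans Vk≡0 (sym Vt≡0)))
    lookup-σ : ∀ {t i} → V t ≡ zero → suc i ≢ t → suc (lookup σ i) ≡ V (suc i)
    lookup-σ {i = i} Vt≡0 i+1≢t = trans (cong suc (lookup∘tabulate _ i)) (suc-predOr _ (nonzero Vt≡0 i+1≢t))
    agree : ∀ t → V t ≡ zero → ∀ k → adjoinZeroᶠ σ t k ≡ V k
    agree zero V0≡0 zero = sym V0≡0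
    agree zero V0≡0 (suc i) = lookup-σ V0≡0 (λ ())
    agree (suc s) Vs+1≡0 zero = begin
      suc (lookup σ s)                                     ≡⟨ cong suc (lookup∘tabulate _ s) ⟩
      suc (predOr (predOr s (V zero)) (V (suc s)))          ≡⟨ cong (suc ∘ predOr (predOr s (V zero))) Vs+1≡0 ⟩
      suc (predOr s (V zero))                              ≡⟨ suc-predOr s (nonzero Vs+1≡0 (λ ())) ⟩
      V zero                                               ∎
      where open ≡-Reasoning
    agree (suc s) Vs+1≡0 (suc i) with i Fin.≟ s
    ... | yes refl = sym Vs+1≡0
    ... | no i≢s = lookup-σ Vs+1≡0 (i≢s ∘ suc-injective)

  ∧≡true : ∀ {a b} → a ∧ b ≡ true → a ≡ true × b ≡ true
  ∧≡true {true} {true} e = refl , refl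

module PermSum {c ℓ} (M : CommutativeMonoid c ℓ) where
  open CommutativeMonoid M renaming (Carrier to C)
  open BigSum M
  open Permutation
  open SetoidReasoning setoid

  private
    fiberᵇ : ∀ {m} → Vec (Fin m) m → Fin (suc m) → Vec (Fin (suc m)) (suc m) → Bool
    fiberᵇ σ t v = isPermᵇ σ ∧ (v ≡ᵇᵛ adjoinZero σ t)

    fiberᵇ-point : ∀ {m} {σ₀ : Vec (Fin m) m} {t₀ v} → Injectiveᵛ σ₀ → adjoinZero σ₀ t₀ ≡ v →
                   ∀ σ t → fiberᵇ σ t v ≡ (σ ≡ᵇᵛ σ₀) ∧ eqᵇ t t₀
    fiberᵇ-point {σ₀ = σ₀} {t₀} {v} inj₀ ≡.refl σ t = ⇔→≡ {z = true} (mk⇔ to from)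
      where
      to : fiberᵇ σ t v ≡ true → (σ ≡ᵇᵛ σ₀) ∧ eqᵇ t t₀ ≡ true
      to e with ≡.refl , ≡.refl ← adjoinZero-cancel {σ = σ₀} {σ} {t₀} {t} (≡ᵇᵛ⇒≡ (proj₂ (∧≡true {isPermᵇ σ} e)))
        rewrite ≡ᵇᵛ-refl σ | eqᵇ-refl t = ≡.refl
      from : (σ ≡ᵇᵛ σ₀) ∧ eqᵇ t t₀ ≡ true → fiberᵇ σ t v ≡ true
      from e with σ≡ , t≡ ← ∧≡true {σ ≡ᵇᵛ σ₀} e
        with ≡.refl ← ≡ᵇᵛ⇒≡ {u = σ} {σ₀} σ≡ | ≡.refl ← eqᵇ⇒≡ {x = t} {t₀} t≡
        rewrite injective⇒isPermᵇ σ inj₀ | ≡ᵇᵛ-refl v = ≡.refl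

    fiberᵇ-nonperm : ∀ {m} {v : Vec (Fin (suc m)) (suc m)} → isPermᵇ v ≡ false → ∀ σ t → fiberᵇ σ t v ≡ false
    fiberᵇ-nonperm {v = v} ¬perm σ t with fiberᵇ σ t v in e
    ... | false = ≡.refl
    ... | true with isPerm-σ , v≡ ← ∧≡true {isPermᵇ σ} e with ≡.refl ← ≡ᵇᵛ⇒≡ {u = v} v≡
      with () ← ≡.trans (≡.sym ¬perm) (injective⇒isPermᵇ v (adjoinZero-injective σ t (isPermᵇ⇒injective σ isPerm-σ)))

    summand-as-fiber-sum : ∀ {m} (g : Vec (Fin (suc m)) (suc m) → C) v →
      (if isPermᵇ v then g v else ε) ≈ ∑ (λ σ → ∑ᶠ (λ t → if fiberᵇ σ t v then g v else ε)) (allVecs m m)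
    summand-as-fiber-sum {m} g v with isPermᵇ v in perm
    ... | false = sym (∑-zero (allVecs m m) (λ σ → ∑-zero (allFin (suc m)) (λ t →
                    reflexive (≡.cong (λ b → if b then g v else ε) (fiberᵇ-nonperm {v = v} perm σ t)))))
    ... | true with σ₀ , t₀ , ≡.refl ← adjoinZero-surjective v (isPermᵇ⇒injective v perm) = sym (begin
      ∑ (λ σ → ∑ᶠ (λ t → if fiberᵇ σ t v then g v else ε)) (allVecs m m)
        ≈⟨ ∑-cong (allVecs m m) (λ σ → ∑ᶠ-cong (λ t → reflexive (≡.cong (λ b → if b then g v else ε) (fiberᵇ-point inj₀ ≡.refl σ t)))) ⟩
      ∑ (λ σ → ∑ᶠ (λ t → if (σ ≡ᵇᵛ σ₀) ∧ eqᵇ t t₀ then g v else ε)) (allVecs m m)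
        ≈⟨ ∑-cong (allVecs m m) (λ σ → ∑ᶠ-cong (λ t → reflexive (if-∧ (σ ≡ᵇᵛ σ₀) {eqᵇ t t₀} {g v}))) ⟩
      ∑ (λ σ → ∑ᶠ (λ t → if σ ≡ᵇᵛ σ₀ then indicator t₀ (g v) t else ε)) (allVecs m m)
        ≈⟨ ∑-cong (allVecs m m) (λ σ → trans (∑-if (σ ≡ᵇᵛ σ₀) (indicator t₀ (g v)) (allFin (suc m))) (if-cong (σ ≡ᵇᵛ σ₀) (∑ᶠ-indicator t₀ (g v)))) ⟩
      ∑ (λ σ → if σ ≡ᵇᵛ σ₀ then g v else ε) (allVecs m m)
        ≈⟨ ∑-allVecs-indicator σ₀ (g v) ⟩
      g v ∎)
      where
      inj₀ = adjoinZero-injective⁻ σ₀ t₀ (isPermᵇ⇒injective v perm)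
      if-∧ : ∀ b {b′ x} → (if b ∧ b′ then x else ε) ≡ (if b then (if b′ then x else ε) else ε)
      if-∧ true = ≡.refl
      if-∧ false = ≡.refl
      if-cong : ∀ b {x y} → x ≈ y → (if b then x else ε) ≈ (if b then y else ε)
      if-cong true p = p
      if-cong false p = refl

    ∑-fiber : ∀ {m} (g : Vec (Fin (suc m)) (suc m) → C) σ t →
              ∑ (λ v → if fiberᵇ σ t v then g v else ε) (allVecs (suc m) (suc m)) ≈ (if isPermᵇ σ then g (adjoinZero σ t) else ε)
    ∑-fiber {m} g σ t with isPermᵇ σ
    ... | false = ∑-ε (allVecs (suc m) (suc m))
    ... | true = trans (∑-cong (allVecs (suc m) (suc m)) at-point) (∑-allVecs-indicator (adjoinZero σ t) _)
      where
      at-point : ∀ v → (if v ≡ᵇᵛ adjoinZero σ t then g v else ε) ≈ (if v ≡ᵇᵛ adjoinZero σ t then g (adjoinZero σ t) else ε)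
      at-point v with v ≡ᵇᵛ adjoinZero σ t in e
      ... | true = reflexive (≡.cong g (≡ᵇᵛ⇒≡ e))
      ... | false = refl

  -- Reindexing along the bijection (σ, t) ↦ adjoinZero σ t: each summand is spread over the fibre
  -- indicator of its preimage, and the two sums are swapped.
  ∑-perms-suc : ∀ {m} (g : Vec (Fin (suc m)) (suc m) → C) →
                ∑ g (perms (suc m)) ≈ ∑ (λ σ → ∑ᶠ (λ t → g (adjoinZero σ t))) (perms m)
  ∑-perms-suc {m} g = begin
    ∑ g (perms (suc m))                                           ≈⟨ ∑-filterᵇ g isPermᵇ Vs′ ⟩
    ∑ (λ v → if isPermᵇ v then g v else ε) Vs′                     ≈⟨ ∑-cong Vs′ (summand-as-fiber-sum g) ⟩
    ∑ (λ v → ∑ (λ σ → ∑ᶠ (λ t → F σ t v)) Vs) Vs′                 ≈⟨ ∑-swap (λ v σ → ∑ᶠ (λ t → F σ t v)) Vs′ Vs ⟩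
    ∑ (λ σ → ∑ (λ v → ∑ᶠ (λ t → F σ t v)) Vs′) Vs                 ≈⟨ ∑-cong Vs (λ σ → ∑-swap (λ v t → F σ t v) Vs′ (allFin (suc m))) ⟩
    ∑ (λ σ → ∑ᶠ (λ t → ∑ (F σ t) Vs′)) Vs                         ≈⟨ ∑-cong Vs (λ σ → ∑ᶠ-cong (∑-fiber g σ)) ⟩
    ∑ (λ σ → ∑ᶠ (λ t → if isPermᵇ σ then g (adjoinZero σ t) else ε)) Vs
                                                                  ≈⟨ ∑-cong Vs (λ σ → ∑-if (isPermᵇ σ) (λ t → g (adjoinZero σ t)) (allFin (suc m))) ⟩
    ∑ (λ σ → if isPermᵇ σ then ∑ᶠ (λ t → g (adjoinZero σ t)) else ε) Vs
                                                                  ≈⟨ sym (∑-filterᵇ (λ σ → ∑ᶠ (λ t → g (adjoinZero σ t))) isPermᵇ Vs) ⟩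
    ∑ (λ σ → ∑ᶠ (λ t → g (adjoinZero σ t))) (perms m)             ∎
    where
    Vs = allVecs m m
    Vs′ = allVecs (suc m) (suc m)
    F : Vec (Fin m) m → Fin (suc m) → Vec (Fin (suc m)) (suc m) → C
    F σ t v = if fiberᵇ σ t v then g v else ε

module Sign where
  open ≡
  open Permutation

  private
    Parity : CommutativeMonoid _ _
    Parity = CommutativeRing.+-commutativeMonoid xor-∧-commutativeRing

  open BigSum Parity

  isEven-length-filterᵇ : ∀ {a} {X : Set a} (p : X → Bool) xs → isEven (length (filterᵇ p xs)) ≡ not (∑ p xs)
  isEven-length-filterᵇ p [] = refl
  isEven-length-filterᵇ p (x ∷ xs) with p x
  ... | true = cong not (isEven-length-filterᵇ p xs)
  ... | false = isEven-length-filterᵇ p xs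

  ∑-cartesianProduct : ∀ {a b} {X : Set a} {Y : Set b} (h : X × Y → Bool) xs (ys : List Y) →
                       ∑ h (cartesianProduct xs ys) ≡ ∑ (λ x → ∑ (λ y → h (x , y)) ys) xs
  ∑-cartesianProduct h [] ys = refl
  ∑-cartesianProduct h (x ∷ xs) ys =
    trans (∑-++ h (map (x ,_) ys) _) (cong₂ _xor_ (∑-map h (x ,_) ys) (∑-cartesianProduct h xs ys))

  isInversionᵇ : ∀ {m} → Vec (Fin m) m → Fin m → Fin m → Bool
  isInversionᵇ σ i j = ltᵇ i j ∧ ltᵇ (lookup σ j) (lookup σ i)

  inversionParity : ∀ {m} → Vec (Fin m) m → Bool
  inversionParity σ = ∑ᶠ (λ i → ∑ᶠ (isInversionᵇ σ i))

  isEven-inversions : ∀ {m} (σ : Vec (Fin m) m) → isEven (inversions σ) ≡ not (inversionParity σ)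
  isEven-inversions {m} σ =
    trans (isEven-length-filterᵇ inv (cartesianProduct (allFin m) (allFin m)))
          (cong not (∑-cartesianProduct inv (allFin m) (allFin m)))
    where
    inv : Fin m × Fin m → Bool
    inv (i , j) = isInversionᵇ σ i j

  <⇒ltᵇ : ∀ {m} {x y : Fin m} → toℕ x Nat.< toℕ y → ltᵇ x y ≡ true
  <⇒ltᵇ {x = x} {y} = dec-true (toℕ x Nat.<? toℕ y)

  ≮⇒ltᵇ-false : ∀ {m} {x y : Fin m} → ¬ toℕ x Nat.< toℕ y → ltᵇ x y ≡ false
  ≮⇒ltᵇ-false {x = x} {y} = dec-false (toℕ x Nat.<? toℕ y)

  ltᵇ-irrefl : ∀ {m} (x : Fin m) → ltᵇ x x ≡ false
  ltᵇ-irrefl x = ≮⇒ltᵇ-false {x = x} (ℕP.<-irrefl refl)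

  ltᵇ-xor-ltᵇ : ∀ {m} {x y : Fin m} → x ≢ y → ltᵇ x y xor ltᵇ y x ≡ true
  ltᵇ-xor-ltᵇ {x = x} {y} x≢y with ℕP.<-cmp (toℕ x) (toℕ y)
  ... | tri< x<y _ y≮x rewrite <⇒ltᵇ {x = x} {y} x<y | ≮⇒ltᵇ-false {x = y} {x} y≮x = refl
  ... | tri≈ _ x≡y _ = ⊥-elim (x≢y (toℕ-injective x≡y))
  ... | tri> x≮y _ y<x rewrite ≮⇒ltᵇ-false {x = x} {y} x≮y | <⇒ltᵇ {x = y} {x} y<x = refl

  inversionParity-fixZero : ∀ {m} (σ : Vec (Fin m) m) → inversionParity (adjoinZero σ zero) ≡ inversionParity σ
  inversionParity-fixZero {m} σ = begin
    inversionParity E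
      ≡⟨ ∑ᶠ-suc (λ i → ∑ᶠ (isInversionᵇ E i)) ⟩
    ∑ᶠ (isInversionᵇ E zero) xor ∑ᶠ (λ i → ∑ᶠ (isInversionᵇ E (suc i)))
      ≡⟨ cong₂ _xor_ (∑-zero (allFin (suc m)) row-zero)
                     (∑ᶠ-cong (λ i → trans (∑ᶠ-suc (isInversionᵇ E (suc i))) (∑ᶠ-cong (row-suc i)))) ⟩
    inversionParity σ ∎
    where
    open ≡-Reasoning
    E = adjoinZero σ zero
    row-zero : ∀ j → isInversionᵇ E zero j ≡ false
    row-zero j rewrite adjoinZero-lookup σ zero zero = ∧-zeroʳ _
    row-suc : ∀ i j → isInversionᵇ E (suc i) (suc j) ≡ isInversionᵇ σ i j
    row-suc i j rewrite adjoinZero-lookup σ zero (suc i) | adjoinZero-lookup σ zero (suc j) = refl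

  flip-parity : ∀ a x d → a xor x ≡ false → (true xor a) xor (d xor x) ≡ not d
  flip-parity false false false _ = refl
  flip-parity false false true  _ = refl
  flip-parity true  true  false _ = refl
  flip-parity true  true  true  _ = refl
  flip-parity false true  _ ()
  flip-parity true  false _ ()

  module _ {m} (σ : Vec (Fin m) m) (s : Fin m) (inj : Injectiveᵛ σ) where
    private
      S = lookup σ
      I = adjoinZero σ (suc s)
      -- Inserting 0 after s removes the inversions in row s and turns column s into [i < s].
      column : Fin m → Bool
      column i = isInversionᵇ σ i s xor ltᵇ i s
      correction : Fin m → Fin m → Bool
      correction i j = indicator s (isInversionᵇ σ s j) i xor indicator s (column i) j

    row-zero-insertZero : ∀ j → isInversionᵇ I zero (suc j) ≡ eqᵇ j s xor ltᵇ (S j) (S s)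
    row-zero-insertZero j rewrite adjoinZero-lookup σ (suc s) zero | adjoinZero-lookup σ (suc s) (suc j)
      with j Fin.≟ s
    ... | yes refl = cong not (sym (ltᵇ-irrefl (S s)))
    ... | no _ = refl

    isInversionᵇ-insertZero : ∀ i j → isInversionᵇ I (suc i) (suc j) ≡ isInversionᵇ σ i j xor correction i j
    isInversionᵇ-insertZero i j rewrite adjoinZero-lookup σ (suc s) (suc i) | adjoinZero-lookup σ (suc s) (suc j)
      with i Fin.≟ s | j Fin.≟ s
    ... | yes refl | yes refl rewrite ltᵇ-irrefl s = refl
    ... | yes refl | no _ = trans (∧-zeroʳ (ltᵇ s j)) (sym (xor-same-xor (isInversionᵇ σ s j)))
      where
      xor-same-xor : ∀ a → a xor (a xor false) ≡ false
      xor-same-xor false = refl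
      xor-same-xor true = refl
    ... | no _ | yes refl = trans (∧-identityʳ (ltᵇ i s)) (xor-cancel (isInversionᵇ σ i s) (ltᵇ i s))
      where
      xor-cancel : ∀ a b → b ≡ a xor (a xor b)
      xor-cancel false b = refl
      xor-cancel true false = refl
      xor-cancel true true = refl
    ... | no _ | no _ = sym (xor-identityʳ _)

    -- For k < s the four terms are [σk < σs], 0, [σs < σk], 1, and σk ≠ σs; for k > s the
    -- first two coincide and the last two vanish.
    inversion-balance : ∀ k → ltᵇ (S k) (S s) xor (isInversionᵇ σ s k xor column k) ≡ false
    inversion-balance k with ℕP.<-cmp (toℕ k) (toℕ s)
    ... | tri< k<s k≢s s≮k rewrite <⇒ltᵇ {x = k} {s} k<s | ≮⇒ltᵇ-false {x = s} {k} s≮k =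
          lem (ltᵇ (S k) (S s)) (ltᵇ (S s) (S k)) (ltᵇ-xor-ltᵇ (λ Sk≡Ss → k≢s (cong toℕ (inj k s Sk≡Ss))))
      where
      lem : ∀ a b → a xor b ≡ true → a xor (false xor (b xor true)) ≡ false
      lem false true _ = refl
      lem true false _ = refl
    ... | tri≈ _ k≡s _ with refl ← toℕ-injective {i = k} {s} k≡s rewrite ltᵇ-irrefl s | ltᵇ-irrefl (S s) = refl
    ... | tri> k≮s _ s<k rewrite ≮⇒ltᵇ-false {x = k} {s} k≮s | <⇒ltᵇ {x = s} {k} s<k = lem (ltᵇ (S k) (S s))
      where
      lem : ∀ a → a xor ((true ∧ a) xor ((false ∧ ltᵇ (S s) (S k)) xor false)) ≡ false
      lem false = refl
      lem true = refl

    inversionParity-insertZero : inversionParity I ≡ not (inversionParity σ)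
    inversionParity-insertZero = begin
      inversionParity I
        ≡⟨ ∑ᶠ-suc (λ i → ∑ᶠ (isInversionᵇ I i)) ⟩
      ∑ᶠ (isInversionᵇ I zero) xor ∑ᶠ (λ i → ∑ᶠ (isInversionᵇ I (suc i)))
        ≡⟨ cong₂ _xor_ (trans (∑ᶠ-suc (isInversionᵇ I zero)) (∑ᶠ-cong row-zero-insertZero))
                       (∑ᶠ-cong (λ i → trans (∑ᶠ-suc (isInversionᵇ I (suc i))) (∑ᶠ-cong (isInversionᵇ-insertZero i)))) ⟩
      ∑ᶠ (λ j → eqᵇ j s xor ltᵇ (S j) (S s)) xor ∑ᶠ (λ i → ∑ᶠ (λ j → isInversionᵇ σ i j xor correction i j))
        ≡⟨ cong₂ _xor_ (∑ᶠ-xor (λ j → eqᵇ j s) (λ j → ltᵇ (S j) (S s)))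
                       (trans (∑ᶠ-cong (λ i → ∑ᶠ-xor (isInversionᵇ σ i) (correction i)))
                              (∑ᶠ-xor (λ i → ∑ᶠ (isInversionᵇ σ i)) (λ i → ∑ᶠ (correction i)))) ⟩
      (∑ᶠ (λ j → eqᵇ j s) xor below) xor (inversionParity σ xor ∑ᶠ (λ i → ∑ᶠ (correction i)))
        ≡⟨ cong₂ _xor_ (cong (_xor below) (trans (∑ᶠ-cong eqᵇ-indicator) (∑ᶠ-indicator s true)))
                       (cong (inversionParity σ xor_) ∑-correction) ⟩
      (true xor below) xor (inversionParity σ xor (row-s xor ∑ᶠ column))
        ≡⟨ flip-parity below (row-s xor ∑ᶠ column) (inversionParity σ) balanced ⟩
      not (inversionParity σ) ∎
      where
      open ≡-Reasoning
      below = ∑ᶠ (λ k → ltᵇ (S k) (S s))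
      row-s = ∑ᶠ (isInversionᵇ σ s)
      ∑ᶠ-xor : ∀ {n} (h g : Fin n → Bool) → ∑ᶠ (λ x → h x xor g x) ≡ ∑ᶠ h xor ∑ᶠ g
      ∑ᶠ-xor {n} h g = ∑-∙ h g (allFin n)
      eqᵇ-indicator : ∀ j → eqᵇ j s ≡ indicator s true j
      eqᵇ-indicator j with eqᵇ j s
      ... | true = refl
      ... | false = refl
      ∑-correction : ∑ᶠ (λ i → ∑ᶠ (correction i)) ≡ row-s xor ∑ᶠ column
      ∑-correction = begin
        ∑ᶠ (λ i → ∑ᶠ (correction i))
          ≡⟨ trans (∑ᶠ-cong (λ i → ∑ᶠ-xor (λ j → indicator s (isInversionᵇ σ s j) i) (indicator s (column i))))
                   (∑ᶠ-xor (λ i → ∑ᶠ (λ j → indicator s (isInversionᵇ σ s j) i)) (λ i → ∑ᶠ (indicator s (column i)))) ⟩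
        ∑ᶠ (λ i → ∑ᶠ (λ j → indicator s (isInversionᵇ σ s j) i)) xor ∑ᶠ (λ i → ∑ᶠ (indicator s (column i)))
          ≡⟨ cong₂ _xor_ (trans (∑-swap (λ i j → indicator s (isInversionᵇ σ s j) i) (allFin m) (allFin m))
                                (∑ᶠ-cong (λ j → ∑ᶠ-indicator s (isInversionᵇ σ s j))))
                         (∑ᶠ-cong (λ i → ∑ᶠ-indicator s (column i))) ⟩
        row-s xor ∑ᶠ column ∎
      balanced : below xor (row-s xor ∑ᶠ column) ≡ false
      balanced = trans (cong (below xor_) (sym (∑ᶠ-xor (isInversionᵇ σ s) column)))
                       (trans (sym (∑ᶠ-xor (λ k → ltᵇ (S k) (S s)) (λ k → isInversionᵇ σ s k xor column k)))
                              (∑-zero (allFin m) inversion-balance))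

  isEven-inversions-fixZero : ∀ {m} (σ : Vec (Fin m) m) →
                              isEven (inversions (adjoinZero σ zero)) ≡ isEven (inversions σ)
  isEven-inversions-fixZero σ =
    trans (isEven-inversions (adjoinZero σ zero)) (trans (cong not (inversionParity-fixZero σ)) (sym (isEven-inversions σ)))

  isEven-inversions-insertZero : ∀ {m} (σ : Vec (Fin m) m) s → Injectiveᵛ σ →
                                 isEven (inversions (adjoinZero σ (suc s))) ≡ not (isEven (inversions σ))
  isEven-inversions-insertZero σ s inj =
    trans (isEven-inversions (adjoinZero σ (suc s)))
          (trans (cong not (inversionParity-insertZero σ s inj)) (cong not (sym (isEven-inversions σ))))

module Cycle where
  open ≡
  open Nat using (_+_; _*_; _∸_)
  open Permutation

  -- The fuel-driven loop inside cycleLen is local to Defs. It is named here by unification against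
  -- the one-step unfolding of cycleLen; the size suc N and the literal 2 are generalised by `with` so
  -- that the unification problem is a pattern.
  mutual
    search : ∀ {M} → Vec (Fin M) M → Fin M → ℕ → ℕ → ℕ
    search = _

    cycleLen-unfold : ∀ {N} (π : Vec (Fin (suc N)) (suc N)) x →
                      cycleLen π x ≡ (if eqᵇ (iter π 1 x) x then 1 else search π x 2 N)
    cycleLen-unfold {N} π x with suc N | 2
    ... | _ | _ = refl

  cycleLen≡search : ∀ {M} (π : Vec (Fin M) M) x → cycleLen π x ≡ search π x 1 M
  cycleLen≡search {suc N} π x = cycleLen-unfold π x

  module _ {M} (π : Vec (Fin M) M) where

    iter-+ : ∀ a b x → iter π (a + b) x ≡ iter π a (iter π b x)
    iter-+ zero b x = refl
    iter-+ (suc a) b x = cong (lookup π) (iter-+ a b x)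

    iter-comm : ∀ a b x → iter π a (iter π b x) ≡ iter π b (iter π a x)
    iter-comm a b x = trans (sym (iter-+ a b x)) (trans (cong (λ n → iter π n x) (ℕP.+-comm a b)) (iter-+ b a x))

    iter-injective : Injectiveᵛ π → ∀ a {x y} → iter π a x ≡ iter π a y → x ≡ y
    iter-injective inj zero e = e
    iter-injective inj (suc a) e = iter-injective inj a (inj _ _ e)

    iter-*-period : ∀ L x → iter π L x ≡ x → ∀ q → iter π (q * L) x ≡ x
    iter-*-period L x ret zero = refl
    iter-*-period L x ret (suc q) = trans (iter-+ L (q * L) x) (trans (cong (iter π L) (iter-*-period L x ret q)) ret)

    iter-%-period : ∀ L x → iter π (suc L) x ≡ x → ∀ n → iter π n x ≡ iter π (n % suc L) x
    iter-%-period L x ret n = trans (cong (λ k → iter π k x) (m≡m%n+[m/n]*n n (suc L)))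
      (trans (iter-+ (n % suc L) _ x) (cong (iter π (n % suc L)) (iter-*-period (suc L) x ret (n / suc L))))

    record IsLeastPeriod (x : Fin M) (L : ℕ) : Set where
      field
        1≤L : 1 ≤ L
        returns : iter π L x ≡ x
        minimal : ∀ j → 1 ≤ j → j < L → iter π j x ≢ x

    leastPeriod-unique : ∀ {x L L′} → IsLeastPeriod x L → IsLeastPeriod x L′ → L ≡ L′
    leastPeriod-unique {x} {L} {L′} p p′ with ℕP.<-cmp L L′
    ... | tri< L<L′ _ _ = ⊥-elim (IsLeastPeriod.minimal p′ L (IsLeastPeriod.1≤L p) L<L′ (IsLeastPeriod.returns p))
    ... | tri≈ _ L≡L′ _ = L≡L′
    ... | tri> _ _ L′<L = ⊥-elim (IsLeastPeriod.minimal p L′ (IsLeastPeriod.1≤L p′) L′<L (IsLeastPeriod.returns p′))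

    search-correct : ∀ x k fuel → Σ ℕ (λ d → d < fuel × iter π (k + d) x ≡ x) →
                     k ≤ search π x k fuel × iter π (search π x k fuel) x ≡ x ×
                     (∀ j → k ≤ j → j < search π x k fuel → iter π j x ≢ x)
    search-correct x k (suc fuel) (d , d<fuel , ret) with eqᵇ (iter π k x) x in found
    ... | true = ℕP.≤-refl , eqᵇ⇒≡ found , λ j k≤j j<k → ⊥-elim (ℕP.<-irrefl refl (ℕP.<-≤-trans j<k k≤j))
    ... | false with d
    ...   | zero = ⊥-elim (eqᵇ-false⇒≢ found (trans (cong (λ n → iter π n x) (sym (ℕP.+-identityʳ k))) ret))
    ...   | suc d′ with search-correct x (suc k) fuel (d′ , ℕP.≤-pred d<fuel , trans (cong (λ n → iter π n x) (sym (ℕP.+-suc k d′))) ret)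
    ...     | k<r , returns , below = ℕP.≤-trans (ℕP.n≤1+n k) k<r , returns , minimal
      where
      minimal : ∀ j → k ≤ j → j < search π x (suc k) fuel → iter π j x ≢ x
      minimal j k≤j j<r with ℕP.m≤n⇒m<n∨m≡n k≤j
      ... | inj₁ k<j = below j k<j j<r
      ... | inj₂ refl = eqᵇ-false⇒≢ found

    returns-within : Injectiveᵛ π → ∀ x → Σ ℕ (λ d → d < M × iter π (1 + d) x ≡ x)
    returns-within inj x with a , b , a<b , e ← pigeonhole (ℕP.n<1+n M) (λ a → iter π (toℕ a) x) =
      d , d<M , iter-injective inj (toℕ a)
        (trans (iter-comm (toℕ a) (suc d) x) (trans (sym (iter-+ (suc d) (toℕ a) x)) (trans (cong (λ n → iter π n x) d+a≡b) (sym e))))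
      where
      d = toℕ b ∸ suc (toℕ a)
      d+a≡b : suc d + toℕ a ≡ toℕ b
      d+a≡b = trans (sym (ℕP.+-suc d (toℕ a))) (ℕP.m∸n+n≡m a<b)
      d<M : d < M
      d<M = ℕP.<-≤-trans (ℕP.m≤m+n (suc d) (toℕ a)) (ℕP.≤-pred (subst (_< suc M) (sym d+a≡b) (toℕ<n b)))

    cycleLen-isLeastPeriod : Injectiveᵛ π → ∀ x → IsLeastPeriod x (cycleLen π x)
    cycleLen-isLeastPeriod inj x with 1≤r , returns , minimal ← search-correct x 1 M (returns-within inj x) = record
      { 1≤L = subst (1 ≤_) (sym (cycleLen≡search π x)) 1≤r
      ; returns = subst (λ n → iter π n x ≡ x) (sym (cycleLen≡search π x)) returns
      ; minimal = λ j 1≤j j<L → minimal j 1≤j (subst (j <_) (cycleLen≡search π x) j<L) }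

    isLeastPeriod⇒cycleLen≡ : Injectiveᵛ π → ∀ {x L} → IsLeastPeriod x L → cycleLen π x ≡ L
    isLeastPeriod⇒cycleLen≡ inj = leastPeriod-unique (cycleLen-isLeastPeriod inj _)

  module _ {a} {A : Set a} (p : A → Bool) where

    any-applyUpTo⁻ : ∀ (h : ℕ → A) n → any p (applyUpTo h n) ≡ true → Σ ℕ λ j → j < n × p (h j) ≡ true
    any-applyUpTo⁻ h (suc n) e with p (h 0) in e0
    ... | true = 0 , s≤s z≤n , e0
    ... | false with j , j<n , q ← any-applyUpTo⁻ (h ∘ suc) n e = suc j , s≤s j<n , q

    any-applyUpTo⁺ : ∀ (h : ℕ → A) n j → j < n → p (h j) ≡ true → any p (applyUpTo h n) ≡ true
    any-applyUpTo⁺ h (suc n) zero j<n q rewrite q = refl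
    any-applyUpTo⁺ h (suc n) (suc j) (s≤s j<n) q rewrite any-applyUpTo⁺ (h ∘ suc) n j j<n q = ∨-zeroʳ _

    all-applyUpTo⁻ : ∀ (h : ℕ → A) n → all p (applyUpTo h n) ≡ true → ∀ j → j < n → p (h j) ≡ true
    all-applyUpTo⁻ h (suc n) e zero j<n with p (h 0) in e0
    ... | true = refl
    all-applyUpTo⁻ h (suc n) e (suc j) (s≤s j<n) with p (h 0)
    ... | true = all-applyUpTo⁻ (h ∘ suc) n e j j<n

    all-applyUpTo⁺ : ∀ (h : ℕ → A) n → (∀ j → j < n → p (h j) ≡ true) → all p (applyUpTo h n) ≡ true
    all-applyUpTo⁺ h zero q = refl
    all-applyUpTo⁺ h (suc n) q rewrite q 0 (s≤s z≤n) = all-applyUpTo⁺ (h ∘ suc) n (λ j j<n → q (suc j) (s≤s j<n))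

  module Orbit {M} (π : Vec (Fin M) M) (inj : Injectiveᵛ π) where

    L : Fin M → ℕ
    L x = cycleLen π x

    period : ∀ x → IsLeastPeriod π x (L x)
    period = cycleLen-isLeastPeriod π inj

    L-suc : ∀ x → Σ ℕ λ K → L x ≡ suc K
    L-suc x with L x | period x
    ... | suc K | _ = K , refl

    iter-reduce : ∀ x n → Σ ℕ λ j → j < L x × iter π n x ≡ iter π j x
    iter-reduce x n with K , L≡ ← L-suc x rewrite L≡ =
      n % suc K , m%n<n n (suc K) , iter-%-period π K x (subst (λ l → iter π l x ≡ x) L≡ (IsLeastPeriod.returns (period x))) n

    cycleOf-applyUpTo : ∀ x → cycleOf π x ≡ applyUpTo (λ k → iter π k x) (L x)
    cycleOf-applyUpTo x = map-upTo (λ k → iter π k x) (L x)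

    iter-sym : ∀ k x y → iter π k x ≡ y → Σ ℕ λ j → iter π j y ≡ x
    iter-sym k x y refl with K , L≡ ← L-suc x = K * k , (begin
      iter π (K * k) (iter π k x) ≡⟨ sym (iter-+ π (K * k) k x) ⟩
      iter π (K * k + k) x        ≡⟨ cong (λ n → iter π n x) (trans (ℕP.+-comm (K * k) k) (ℕP.*-comm (suc K) k)) ⟩
      iter π (k * suc K) x        ≡⟨ iter-*-period π (suc K) x (subst (λ l → iter π l x ≡ x) L≡ (IsLeastPeriod.returns (period x))) k ⟩
      x                           ∎)
      where open ≡-Reasoning

    isLeastPeriod-iter : ∀ {x K} → IsLeastPeriod π x K → ∀ j → IsLeastPeriod π (iter π j x) K
    isLeastPeriod-iter {x} {K} p j = record
      { 1≤L = IsLeastPeriod.1≤L p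
      ; returns = trans (iter-comm π K j x) (cong (iter π j) (IsLeastPeriod.returns p))
      ; minimal = λ r 1≤r r<K e → IsLeastPeriod.minimal p r 1≤r r<K (iter-injective π inj j (trans (iter-comm π j r x) e)) }

    L-iter : ∀ x j → L (iter π j x) ≡ L x
    L-iter x j = isLeastPeriod⇒cycleLen≡ π inj (isLeastPeriod-iter (period x) j)

    onCycleᵇ : Fin M → Fin M → Bool
    onCycleᵇ y x = any (eqᵇ y) (cycleOf π x)

    onCycleᵇ⇒iter : ∀ y x → onCycleᵇ y x ≡ true → Σ ℕ λ j → j < L x × iter π j x ≡ y
    onCycleᵇ⇒iter y x e with j , j<L , q ← any-applyUpTo⁻ (eqᵇ y) (λ k → iter π k x) (L x)
                                              (subst (λ l → any (eqᵇ y) l ≡ true) (cycleOf-applyUpTo x) e)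
      = j , j<L , sym (eqᵇ⇒≡ q)

    iter⇒onCycleᵇ : ∀ y x n → iter π n x ≡ y → onCycleᵇ y x ≡ true
    iter⇒onCycleᵇ y x n q with j , j<L , r ← iter-reduce x n =
      subst (λ l → any (eqᵇ y) l ≡ true) (sym (cycleOf-applyUpTo x))
        (any-applyUpTo⁺ (eqᵇ y) (λ k → iter π k x) (L x) j j<L (subst (λ z → eqᵇ y z ≡ true) (trans (sym q) r) (eqᵇ-refl y)))

    onCycleᵇ-false⇒iter≢ : ∀ y x → onCycleᵇ y x ≡ false → ∀ n → iter π n x ≢ y
    onCycleᵇ-false⇒iter≢ y x e n q with () ← trans (sym (iter⇒onCycleᵇ y x n q)) e

    isLeader⇒leᵇ-iter : ∀ y → isLeader π y ≡ true → ∀ n → leᵇ y (iter π n y) ≡ true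
    isLeader⇒leᵇ-iter y e n with j , j<L , r ← iter-reduce y n =
      trans (cong (leᵇ y) r)
            (all-applyUpTo⁻ (leᵇ y) (λ k → iter π k y) (L y) (subst (λ l → all (leᵇ y) l ≡ true) (cycleOf-applyUpTo y) e) j j<L)

    leᵇ-iter⇒isLeader : ∀ y → (∀ n → leᵇ y (iter π n y) ≡ true) → isLeader π y ≡ true
    leᵇ-iter⇒isLeader y q =
      subst (λ l → all (leᵇ y) l ≡ true) (sym (cycleOf-applyUpTo y)) (all-applyUpTo⁺ (leᵇ y) (λ k → iter π k y) (L y) (λ j _ → q j))

  ≤⇒leᵇ : ∀ {m} {x y : Fin m} → toℕ x ≤ toℕ y → leᵇ x y ≡ true
  ≤⇒leᵇ {x = x} {y} = dec-true (toℕ x Nat.≤? toℕ y)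

  leᵇ⇒≤ : ∀ {m} {x y : Fin m} → leᵇ x y ≡ true → toℕ x ≤ toℕ y
  leᵇ⇒≤ {x = x} {y} e = ℕP.≤ᵇ⇒≤ (toℕ x) (toℕ y) (subst T (sym e) _)

  leᵇ-suc : ∀ {m} (x y : Fin m) → leᵇ (suc x) (suc y) ≡ leᵇ x y
  leᵇ-suc x y with toℕ x
  ... | zero = refl
  ... | suc _ = refl

  all-leᵇ-map-suc : ∀ {m} (x : Fin m) (γ : List (Fin m)) → all (leᵇ (suc x)) (map suc γ) ≡ all (leᵇ x) γ
  all-leᵇ-map-suc x [] = refl
  all-leᵇ-map-suc x (y ∷ γ) = cong₂ _∧_ (leᵇ-suc x y) (all-leᵇ-map-suc x γ)

  applyUpTo-cong : ∀ {a} {A : Set a} {h g : ℕ → A} → (∀ k → h k ≡ g k) → ∀ n → applyUpTo h n ≡ applyUpTo g n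
  applyUpTo-cong e zero = refl
  applyUpTo-cong e (suc n) = cong₂ _∷_ (e 0) (applyUpTo-cong (e ∘ suc) n)

  ≤-suc-elim : ∀ {p} {P : ℕ → Set p} {n} → (∀ j → j ≤ n → P j) → P (suc n) → ∀ j → j ≤ suc n → P j
  ≤-suc-elim below top j j≤1+n with ℕP.m≤n⇒m<n∨m≡n j≤1+n
  ... | inj₁ j<1+n = below j (ℕP.≤-pred j<1+n)
  ... | inj₂ refl = top

  argmin≤ : (g : ℕ → ℕ) (n : ℕ) → Σ ℕ λ k → k ≤ n × (∀ j → j ≤ n → g k ≤ g j)
  argmin≤ g zero = 0 , z≤n , λ { zero _ → ℕP.≤-refl }
  argmin≤ g (suc n) with k , k≤n , least ← argmin≤ g n | ℕP.≤-total (g k) (g (suc n))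
  ... | inj₁ gk≤ = k , ℕP.m≤n⇒m≤1+n k≤n , ≤-suc-elim least gk≤
  ... | inj₂ g≤gk = suc n , ℕP.≤-refl , ≤-suc-elim (λ j j≤n → ℕP.≤-trans g≤gk (least j j≤n)) ℕP.≤-refl

  module Leader {M} (π : Vec (Fin M) M) (inj : Injectiveᵛ π) where
    open Orbit π inj

    leader-exists : ∀ x → Σ (Fin M) λ l → onCycleᵇ l x ≡ true × isLeader π l ≡ true
    leader-exists x with K , L≡ ← L-suc x with k , k≤K , least ← argmin≤ (λ k → toℕ (iter π k x)) K =
      iter π k x , iter⇒onCycleᵇ _ x k refl , leᵇ-iter⇒isLeader _ below
      where
      below : ∀ n → leᵇ (iter π k x) (iter π n (iter π k x)) ≡ true
      below n with j , j<L , r ← iter-reduce x (n + k) =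
        ≤⇒leᵇ (subst (λ z → toℕ (iter π k x) ≤ toℕ z) (trans (sym r) (iter-+ π n k x)) (least j (ℕP.≤-pred (subst (j <_) L≡ j<L))))

    leader-unique : ∀ x l l′ → onCycleᵇ l x ≡ true → isLeader π l ≡ true →
                    onCycleᵇ l′ x ≡ true → isLeader π l′ ≡ true → l ≡ l′
    leader-unique x l l′ l∈ lead l′∈ lead′ =
      toℕ-injective (ℕP.≤-antisym (≤-other l l′ l∈ lead l′∈) (≤-other l′ l l′∈ lead′ l∈))
      where
      ≤-other : ∀ l l′ → onCycleᵇ l x ≡ true → isLeader π l ≡ true → onCycleᵇ l′ x ≡ true → toℕ l ≤ toℕ l′
      ≤-other l l′ l∈ lead l′∈ with j , _ , xj≡l ← onCycleᵇ⇒iter l x l∈ | j′ , _ , xj′≡l′ ← onCycleᵇ⇒iter l′ x l′∈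
        with e , le≡x ← iter-sym j x l xj≡l =
        leᵇ⇒≤ (subst (λ z → leᵇ l z ≡ true) (trans (iter-+ π j′ e l) (trans (cong (iter π j′) le≡x) xj′≡l′))
                     (isLeader⇒leᵇ-iter l lead (j′ + e)))

  module _ {m} {σ : Vec (Fin m) m} {P : Vec (Fin (suc m)) (suc m)} (inj : Injectiveᵛ σ) (injP : Injectiveᵛ P)
           {x : Fin m} (commutes : ∀ k → iter P k (suc x) ≡ suc (iter σ k x)) where
    private
      module Oσ = Orbit σ inj
      module OP = Orbit P injP

    cycleLen-lift : cycleLen P (suc x) ≡ cycleLen σ x
    cycleLen-lift = isLeastPeriod⇒cycleLen≡ P injP (record
      { 1≤L = IsLeastPeriod.1≤L (Oσ.period x)
      ; returns = trans (commutes (cycleLen σ x)) (cong suc (IsLeastPeriod.returns (Oσ.period x)))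
      ; minimal = λ j 1≤j j<L e → IsLeastPeriod.minimal (Oσ.period x) j 1≤j j<L (suc-injective (trans (sym (commutes j)) e)) })

    cycleOf-lift : cycleOf P (suc x) ≡ map suc (cycleOf σ x)
    cycleOf-lift = begin
      cycleOf P (suc x)                                          ≡⟨ OP.cycleOf-applyUpTo (suc x) ⟩
      applyUpTo (λ k → iter P k (suc x)) (cycleLen P (suc x))    ≡⟨ cong (applyUpTo (λ k → iter P k (suc x))) cycleLen-lift ⟩
      applyUpTo (λ k → iter P k (suc x)) (cycleLen σ x)          ≡⟨ applyUpTo-cong commutes (cycleLen σ x) ⟩
      applyUpTo (λ k → suc (iter σ k x)) (cycleLen σ x)          ≡⟨ sym (map-applyUpTo (λ k → iter σ k x) suc (cycleLen σ x)) ⟩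
      map suc (applyUpTo (λ k → iter σ k x) (cycleLen σ x))      ≡⟨ cong (map suc) (sym (Oσ.cycleOf-applyUpTo x)) ⟩
      map suc (cycleOf σ x)                                      ∎
      where open ≡-Reasoning

    isLeader-lift : isLeader P (suc x) ≡ isLeader σ x
    isLeader-lift = trans (cong (all (leᵇ (suc x))) cycleOf-lift) (all-leᵇ-map-suc x (cycleOf σ x))

  iter-fixZero : ∀ {m} (σ : Vec (Fin m) m) x k → iter (adjoinZero σ zero) k (suc x) ≡ suc (iter σ k x)
  iter-fixZero σ x zero = refl
  iter-fixZero σ x (suc k) =
    trans (cong (lookup (adjoinZero σ zero)) (iter-fixZero σ x k)) (adjoinZero-lookup σ zero (suc (iter σ k x)))

  module InsertZero {m} (σ : Vec (Fin m) m) (s : Fin m) (inj : Injectiveᵛ σ) where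
    open Orbit σ inj

    I = adjoinZero σ (suc s)

    injI : Injectiveᵛ I
    injI = adjoinZero-injective σ (suc s) inj

    private module OI = Orbit I injI

    iter-off-cycle : ∀ x → onCycleᵇ x s ≡ false → ∀ k → iter I k (suc x) ≡ suc (iter σ k x)
    iter-off-cycle x off zero = refl
    iter-off-cycle x off (suc k) = trans (cong (lookup I) (iter-off-cycle x off k))
      (trans (adjoinZero-lookup σ (suc s) (suc (iter σ k x))) (adjoinZeroᶠ-≢ σ never-s))
      where
      never-s : iter σ k x ≢ s
      never-s xk≡s with j , sj≡x ← iter-sym k x s xk≡s = onCycleᵇ-false⇒iter≢ x s off j sj≡x

    iter-zero : ∀ r → suc r ≤ L s → iter I (suc r) zero ≡ suc (iter σ (suc r) s)
    iter-zero zero _ = adjoinZero-lookup σ (suc s) zero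
    iter-zero (suc r) r+2≤L = trans (cong (lookup I) (iter-zero r (ℕP.<⇒≤ r+2≤L)))
      (trans (adjoinZero-lookup σ (suc s) (suc (iter σ (suc r) s)))
             (adjoinZeroᶠ-≢ σ (IsLeastPeriod.minimal (period s) (suc r) (s≤s z≤n) r+2≤L)))

    iter-zero-returns : iter I (suc (L s)) zero ≡ zero
    iter-zero-returns with K , L≡ ← L-suc s = begin
      lookup I (iter I (L s) zero)   ≡⟨ cong (lookup I ∘ (λ n → iter I n zero)) L≡ ⟩
      lookup I (iter I (suc K) zero) ≡⟨ cong (lookup I) (iter-zero K (ℕP.≤-reflexive (sym L≡))) ⟩
      lookup I (suc (iter σ (suc K) s)) ≡⟨ cong (lookup I ∘ suc) (trans (cong (λ n → iter σ n s) (sym L≡)) (IsLeastPeriod.returns (period s))) ⟩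
      lookup I (suc s)               ≡⟨ trans (adjoinZero-lookup σ (suc s) (suc s)) (adjoinZeroᶠ-after σ s) ⟩
      zero                           ∎
      where open ≡-Reasoning

    cycleLen-zero : cycleLen I zero ≡ suc (L s)
    cycleLen-zero = isLeastPeriod⇒cycleLen≡ I injI (record
      { 1≤L = s≤s z≤n ; returns = iter-zero-returns ; minimal = minimal })
      where
      minimal : ∀ j → 1 ≤ j → j < suc (L s) → iter I j zero ≢ zero
      minimal (suc r) _ (s≤s r<L) e with () ← trans (sym (iter-zero r r<L)) e

    isLeader-zero : isLeader I zero ≡ true
    isLeader-zero = OI.leᵇ-iter⇒isLeader zero (λ n → refl)

    reaches-zero : ∀ x → onCycleᵇ x s ≡ true → Σ ℕ λ n → iter I n (suc x) ≡ zero
    reaches-zero x on with onCycleᵇ⇒iter x s on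
    ... | zero , _ , refl = 1 , trans (adjoinZero-lookup σ (suc s) (suc s)) (adjoinZeroᶠ-after σ s)
    ... | suc j , j<L , refl = L s ∸ j , (begin
      iter I (L s ∸ j) (suc (iter σ (suc j) s)) ≡⟨ cong (iter I (L s ∸ j)) (sym (iter-zero j (ℕP.<⇒≤ j<L))) ⟩
      iter I (L s ∸ j) (iter I (suc j) zero)     ≡⟨ sym (iter-+ I (L s ∸ j) (suc j) zero) ⟩
      iter I (L s ∸ j + suc j) zero              ≡⟨ cong (λ n → iter I n zero) (trans (ℕP.+-suc (L s ∸ j) j) (cong suc (ℕP.m∸n+n≡m (ℕP.<⇒≤ (ℕP.<-trans (ℕP.n<1+n j) j<L))))) ⟩
      iter I (suc (L s)) zero                    ≡⟨ iter-zero-returns ⟩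
      zero                                       ∎)
      where open ≡-Reasoning

    isLeader-on-cycle : ∀ x → onCycleᵇ x s ≡ true → isLeader I (suc x) ≡ false
    isLeader-on-cycle x on with n , reach ← reaches-zero x on =
      ¬-not (λ lead → zero-below (trans (sym (cong (leᵇ (suc x)) reach)) (OI.isLeader⇒leᵇ-iter (suc x) lead n)))
      where
      zero-below : leᵇ (suc x) zero ≢ true
      zero-below ()

module CycleFactors {c₁ ℓ₁ c₂ ℓ₂} (A : CommutativeRing c₁ ℓ₁) (B : CommutativeRing c₂ ℓ₂)
                    (f : CommutativeRing.Carrier A → CommutativeRing.Carrier B)
                    (f-cong : ∀ {x y} → CommutativeRing._≈_ A x y → CommutativeRing._≈_ B (f x) (f y)) where
  private
    module A = CommutativeRing A
    module B = CommutativeRing B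
    module ΠA = BigSum A.*-commutativeMonoid
    module ΠB = BigSum B.*-commutativeMonoid
  open B using (_≈_; _*_)
  open Nat using (_+_)
  open Permutation using (Injectiveᵛ; adjoinZero)
  open Cycle

  cycleFactor : ∀ {m} → Vec (Fin m) m → (Fin m → A.Carrier) → Fin m → B.Carrier
  cycleFactor π a x = fCycle A B f (cycleOf π x) a

  leaderFactor : ∀ {m} → Vec (Fin m) m → (Fin m → A.Carrier) → Fin m → B.Carrier
  leaderFactor π a x = if isLeader π x then cycleFactor π a x else B.1#

  fPerm-∏-leaders : ∀ {m} (π : Vec (Fin m) m) a → fPerm A B f π a ≈ ΠB.∑ᶠ (leaderFactor π a)
  fPerm-∏-leaders {m} π a = B.trans
    (B.reflexive (ΠB.∑-map (λ γ → fCycle A B f γ a) (cycleOf π) (filterᵇ (isLeader π) (allFin m))))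
    (ΠB.∑-filterᵇ (cycleFactor π a) (isLeader π) (allFin m))

  leaderFactor-lift : ∀ {m} {σ : Vec (Fin m) m} {P : Vec (Fin (suc m)) (suc m)} (inj : Injectiveᵛ σ) (injP : Injectiveᵛ P)
                      {x} → (∀ k → iter P k (suc x) ≡ suc (iter σ k x)) →
                      ∀ a → leaderFactor P (A.1# ∷ᶠ a) (suc x) ≡ leaderFactor σ a x
  leaderFactor-lift {σ = σ} {P} inj injP {x} commutes a =
    ≡.cong₂ (λ b w → if b then w else B.1#) (isLeader-lift inj injP commutes)
      (≡.cong f (≡.trans (≡.cong (ΠA.∑ (A.1# ∷ᶠ a)) (cycleOf-lift inj injP commutes)) (ΠA.∑-map (A.1# ∷ᶠ a) suc (cycleOf σ x))))

  module _ {m} (σ : Vec (Fin m) m) (inj : Injectiveᵛ σ) (a : Fin m → A.Carrier) where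
    open Orbit σ inj

    cycleFactor≈ : ∀ x → cycleFactor σ a x ≈ f (ΠA.∑< (λ k → a (iter σ k x)) (L x))
    cycleFactor≈ x = B.reflexive (≡.cong f (≡.trans (≡.cong (ΠA.∑ a) (cycleOf-applyUpTo x)) (ΠA.∑-applyUpTo a (λ k → iter σ k x) (L x))))

    cycleFactor-iter : ∀ x j → cycleFactor σ a (iter σ j x) ≈ cycleFactor σ a x
    cycleFactor-iter x j = begin
      cycleFactor σ a (iter σ j x)                            ≈⟨ cycleFactor≈ (iter σ j x) ⟩
      f (ΠA.∑< (λ k → a (iter σ k (iter σ j x))) (L (iter σ j x))) ≡⟨ ≡.cong (f ∘′ ΠA.∑< (λ k → a (iter σ k (iter σ j x)))) (L-iter x j) ⟩
      f (ΠA.∑< (λ k → a (iter σ k (iter σ j x))) (L x))       ≈⟨ f-cong (ΠA.∑<-cong (L x) (λ k _ → A.reflexive (≡.cong a (≡.sym (iter-+ σ k j x))))) ⟩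
      f (ΠA.∑< (λ k → a (iter σ (k + j) x)) (L x))            ≈⟨ f-cong (ΠA.∑<-shift-periodic (λ k → a (iter σ k x)) (L x) periodic j) ⟩
      f (ΠA.∑< (λ k → a (iter σ k x)) (L x))                  ≈⟨ B.sym (cycleFactor≈ x) ⟩
      cycleFactor σ a x                                       ∎
      where
      open SetoidReasoning B.setoid
      periodic : ∀ i → a (iter σ (i + L x) x) A.≈ a (iter σ i x)
      periodic i = A.reflexive (≡.cong a (≡.trans (iter-+ σ i (L x) x) (≡.cong (iter σ i) (IsLeastPeriod.returns (period x)))))

  fPerm-fixZero : ∀ {m} (σ : Vec (Fin m) m) → Injectiveᵛ σ → ∀ a →
                  fPerm A B f (adjoinZero σ zero) (A.1# ∷ᶠ a) ≈ f A.1# * fPerm A B f σ a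
  fPerm-fixZero σ inj a = begin
    fPerm A B f E a₀                                             ≈⟨ fPerm-∏-leaders E a₀ ⟩
    ΠB.∑ᶠ (leaderFactor E a₀)                                    ≡⟨ ΠB.∑ᶠ-suc (leaderFactor E a₀) ⟩
    leaderFactor E a₀ zero * ΠB.∑ᶠ (λ i → leaderFactor E a₀ (suc i))
      ≈⟨ B.*-cong (f-cong (A.*-identityʳ A.1#)) (ΠB.∑ᶠ-cong (λ i → B.reflexive (leaderFactor-lift inj injE (iter-fixZero σ i) a))) ⟩
    f A.1# * ΠB.∑ᶠ (leaderFactor σ a)                            ≈⟨ B.*-cong B.refl (B.sym (fPerm-∏-leaders σ a)) ⟩
    f A.1# * fPerm A B f σ a                                     ∎
    where
    open SetoidReasoning B.setoid
    E = adjoinZero σ zero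
    injE = Permutation.adjoinZero-injective σ zero inj
    a₀ = A.1# ∷ᶠ a

  module _ {m} (σ : Vec (Fin m) m) (s : Fin m) (inj : Injectiveᵛ σ) (a : Fin m → A.Carrier) where
    open InsertZero σ s inj
    open Orbit σ inj
    private
      a₀ = A.1# ∷ᶠ a

    cycleFactor-zero : cycleFactor I a₀ zero ≈ cycleFactor σ a s
    cycleFactor-zero = begin
      cycleFactor I a₀ zero                                       ≈⟨ cycleFactor≈ I injI a₀ zero ⟩
      f (ΠA.∑< (λ k → a₀ (iter I k zero)) (cycleLen I zero))      ≡⟨ ≡.cong (f ∘′ ΠA.∑< (λ k → a₀ (iter I k zero))) cycleLen-zero ⟩
      f (ΠA.∑< (λ k → a₀ (iter I k zero)) (suc (L s)))            ≡⟨ ≡.cong f (ΠA.∑<-suc (λ k → a₀ (iter I k zero)) (L s)) ⟩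
      f (A.1# A.* ΠA.∑< (λ k → a₀ (iter I (suc k) zero)) (L s))   ≈⟨ f-cong (A.*-identityˡ _) ⟩
      f (ΠA.∑< (λ k → a₀ (iter I (suc k) zero)) (L s))            ≈⟨ f-cong (ΠA.∑<-cong (L s) (λ k k<L → A.reflexive (≡.cong a₀ (iter-zero k k<L)))) ⟩
      f (ΠA.∑< (λ k → a (iter σ (suc k) s)) (L s))                ≈⟨ f-cong (ΠA.∑<-rotate (λ k → a (iter σ k s)) (L s) (A.reflexive (≡.cong a (IsLeastPeriod.returns (period s))))) ⟩
      f (ΠA.∑< (λ k → a (iter σ k s)) (L s))                      ≈⟨ B.sym (cycleFactor≈ σ inj a s) ⟩
      cycleFactor σ a s                                           ∎
      where open SetoidReasoning B.setoid

    private
      onCycleFactor offCycleFactor : Fin m → B.Carrier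
      onCycleFactor i = if onCycleᵇ i s then leaderFactor σ a i else B.1#
      offCycleFactor i = if onCycleᵇ i s then B.1# else leaderFactor σ a i

    -- The cycle through s has exactly one leader, and its factor does not depend on the starting point.
    ∏-onCycleFactor : ΠB.∑ᶠ onCycleFactor ≈ cycleFactor σ a s
    ∏-onCycleFactor = from-leader (Leader.leader-exists σ inj s)
      where
      from-leader : Σ (Fin m) (λ l → onCycleᵇ l s ≡ true × isLeader σ l ≡ true) → ΠB.∑ᶠ onCycleFactor ≈ cycleFactor σ a s
      from-leader (l , l-on , l-lead) = begin
        ΠB.∑ᶠ onCycleFactor ≈⟨ ΠB.∑ᶠ-single l off-leader ⟩
        onCycleFactor l     ≡⟨ ≡.cong₂ (λ on lead → if on then (if lead then cycleFactor σ a l else B.1#) else B.1#) l-on l-lead ⟩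
        cycleFactor σ a l   ≈⟨ factor-l ⟩
        cycleFactor σ a s   ∎
        where
        open SetoidReasoning B.setoid
        factor-l : cycleFactor σ a l ≈ cycleFactor σ a s
        factor-l = along (onCycleᵇ⇒iter l s l-on)
          where
          along : Σ ℕ (λ j → j < L s × iter σ j s ≡ l) → cycleFactor σ a l ≈ cycleFactor σ a s
          along (j , _ , sʲ≡l) = B.trans (B.reflexive (≡.cong (cycleFactor σ a) (≡.sym sʲ≡l))) (cycleFactor-iter σ inj a s j)
        off-leader : ∀ i → i ≢ l → onCycleFactor i ≈ B.1#
        off-leader i i≢l = both-or-1 (onCycleᵇ i s) (isLeader σ i)
          (λ on lead → i≢l (Leader.leader-unique σ inj s i l on lead l-on l-lead))
          where
          both-or-1 : ∀ b b′ {x} → (b ≡ true → b′ ≡ true → ⊥) → (if b then (if b′ then x else B.1#) else B.1#) ≈ B.1#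
          both-or-1 false _ _ = B.refl
          both-or-1 true false _ = B.refl
          both-or-1 true true never = ⊥-elim (never ≡.refl ≡.refl)

    fPerm-insertZero : fPerm A B f I a₀ ≈ fPerm A B f σ a
    fPerm-insertZero = begin
      fPerm A B f I a₀                                               ≈⟨ fPerm-∏-leaders I a₀ ⟩
      ΠB.∑ᶠ (leaderFactor I a₀)                                      ≡⟨ ΠB.∑ᶠ-suc (leaderFactor I a₀) ⟩
      leaderFactor I a₀ zero * ΠB.∑ᶠ (λ i → leaderFactor I a₀ (suc i))
        ≈⟨ B.*-cong (B.trans (B.reflexive (≡.cong (λ b → if b then cycleFactor I a₀ zero else B.1#) isLeader-zero)) cycleFactor-zero)
                    (ΠB.∑ᶠ-cong leaderFactor-suc) ⟩
      cycleFactor σ a s * ΠB.∑ᶠ offCycleFactor                       ≈⟨ B.*-cong (B.sym ∏-onCycleFactor) B.refl ⟩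
      ΠB.∑ᶠ onCycleFactor * ΠB.∑ᶠ offCycleFactor                     ≈⟨ B.sym (ΠB.∑-∙ onCycleFactor offCycleFactor (allFin m)) ⟩
      ΠB.∑ᶠ (λ i → onCycleFactor i * offCycleFactor i)               ≈⟨ B.sym (ΠB.∑ᶠ-cong split) ⟩
      ΠB.∑ᶠ (leaderFactor σ a)                                       ≈⟨ B.sym (fPerm-∏-leaders σ a) ⟩
      fPerm A B f σ a                                                ∎
      where
      open SetoidReasoning B.setoid
      by-cases : ∀ b {x u v} → (b ≡ true → x ≈ u) → (b ≡ false → x ≈ v) → x ≈ (if b then u else v)
      by-cases true on _ = on ≡.refl
      by-cases false _ off = off ≡.refl
      leaderFactor-suc : ∀ i → leaderFactor I a₀ (suc i) ≈ offCycleFactor i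
      leaderFactor-suc i = by-cases (onCycleᵇ i s)
        (λ on → B.reflexive (≡.cong (λ b → if b then cycleFactor I a₀ (suc i) else B.1#) (isLeader-on-cycle i on)))
        (λ off → B.reflexive (leaderFactor-lift inj injI (iter-off-cycle i off) a))
      split : ∀ i → leaderFactor σ a i ≈ onCycleFactor i * offCycleFactor i
      split i = ΠB.if-ε-split (onCycleᵇ i s) (leaderFactor σ a i)

module PhiRecursion {c₁ ℓ₁ c₂ ℓ₂} (A : CommutativeRing c₁ ℓ₁) (B : CommutativeRing c₂ ℓ₂)
                    (f : CommutativeRing.Carrier A → CommutativeRing.Carrier B)
                    (f-cong : ∀ {x y} → CommutativeRing._≈_ A x y → CommutativeRing._≈_ B (f x) (f y)) where
  private
    module A = CommutativeRing A
    module B = CommutativeRing B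
    module ΣB = BigSum B.+-commutativeMonoid
  open B using (_≈_; _*_; _+_; -_)
  open RingProperties B.ring using (-‿involutive; -‿distribʳ-*; -‿distribˡ-*; -‿+-comm; -0#≈0#)
  open Permutation using (Injectiveᵛ; adjoinZero; isPermᵇ; isPermᵇ⇒injective)
  open PermSum B.+-commutativeMonoid using (∑-perms-suc)
  open Sign using (isEven-inversions-fixZero; isEven-inversions-insertZero)
  open CycleFactors A B f f-cong using (fPerm-fixZero; fPerm-insertZero)
  open SetoidReasoning B.setoid

  ± : Bool → B.Carrier → B.Carrier
  ± b x = if b then x else - x

  ±-cong : ∀ b {x y} → x ≈ y → ± b x ≈ ± b y
  ±-cong true x≈y = x≈y
  ±-cong false x≈y = B.-‿cong x≈y

  ±-* : ∀ b c x → ± b (c * x) ≈ c * ± b x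
  ±-* true c x = B.refl
  ±-* false c x = -‿distribʳ-* c x

  ±-not : ∀ b x → ± (not b) x ≈ - ± b x
  ±-not true x = B.refl
  ±-not false x = B.sym (-‿involutive x)

  ε[_] : ∀ {m} → Vec (Fin m) m → B.Carrier → B.Carrier
  ε[ σ ] = ± (isEven (inversions σ))

  signed-fixZero : ∀ {m} (σ : Vec (Fin m) m) x → ε[ adjoinZero σ zero ] x ≡ ε[ σ ] x
  signed-fixZero σ x = ≡.cong (λ b → ± b x) (isEven-inversions-fixZero σ)

  signed-insertZero : ∀ {m} (σ : Vec (Fin m) m) s → Injectiveᵛ σ → ∀ x → ε[ adjoinZero σ (suc s) ] x ≈ - ε[ σ ] x
  signed-insertZero σ s inj x =
    B.trans (B.reflexive (≡.cong (λ b → ± b x) (isEven-inversions-insertZero σ s inj))) (±-not (isEven (inversions σ)) x)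

  ∑ᶠ-const-neg : ∀ m x → ΣB.∑ᶠ {m} (λ _ → - x) ≈ - (_·_ {R = B} m B.1# * x)
  ∑ᶠ-const-neg zero x = B.sym (B.trans (B.-‿cong (B.zeroˡ x)) -0#≈0#)
  ∑ᶠ-const-neg (suc m) x = begin
    ΣB.∑ᶠ {suc m} (λ _ → - x)     ≡⟨ ΣB.∑ᶠ-suc {m} (λ _ → - x) ⟩
    - x + ΣB.∑ᶠ {m} (λ _ → - x)   ≈⟨ B.+-cong B.refl (∑ᶠ-const-neg m x) ⟩
    - x + - (k * x)               ≈⟨ -‿+-comm x (k * x) ⟩
    - (x + k * x)                 ≈⟨ B.-‿cong (B.+-cong (B.sym (B.*-identityˡ x)) B.refl) ⟩
    - (B.1# * x + k * x)          ≈⟨ B.-‿cong (B.sym (B.distribʳ x B.1# k)) ⟩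
    - ((B.1# + k) * x)            ∎
    where k = _·_ {R = B} m B.1#

  ∑-*ˡ : ∀ {a} {X : Set a} c (h : X → B.Carrier) xs → ΣB.∑ (λ x → c * h x) xs ≈ c * ΣB.∑ h xs
  ∑-*ˡ c h [] = B.sym (B.zeroʳ c)
  ∑-*ˡ c h (x ∷ xs) = B.trans (B.+-cong B.refl (∑-*ˡ c h xs)) (B.sym (B.distribˡ c _ _))

  Φ-cons-1 : ∀ m (a : Fin m → A.Carrier) →
             Φ A B (suc m) f (A.1# ∷ᶠ a) ≈ (f A.1# + - (_·_ {R = B} m B.1#)) * Φ A B m f a
  Φ-cons-1 m a = begin
    Φ A B (suc m) f a₀                                           ≈⟨ ∑-perms-suc g ⟩
    ΣB.∑ (λ σ → ΣB.∑ᶠ (λ t → g (adjoinZero σ t))) (perms m)      ≈⟨ ΣB.∑-filterᵇ-cong isPermᵇ (allVecs m m) per-σ ⟩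
    ΣB.∑ (λ σ → c * ε[ σ ] (F σ)) (perms m)                      ≈⟨ ∑-*ˡ c (λ σ → ε[ σ ] (F σ)) (perms m) ⟩
    c * Φ A B m f a                                              ∎
    where
    a₀ = A.1# ∷ᶠ a
    F : Vec (Fin m) m → B.Carrier
    F σ = fPerm A B f σ a
    g : Vec (Fin (suc m)) (suc m) → B.Carrier
    g v = ε[ v ] (fPerm A B f v a₀)
    k = _·_ {R = B} m B.1#
    c = f A.1# + - k
    per-σ : ∀ σ → isPermᵇ σ ≡ true → ΣB.∑ᶠ (λ t → g (adjoinZero σ t)) ≈ c * ε[ σ ] (F σ)
    per-σ σ perm = begin
      ΣB.∑ᶠ (λ t → g (adjoinZero σ t))                          ≡⟨ ΣB.∑ᶠ-suc (λ t → g (adjoinZero σ t)) ⟩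
      g (adjoinZero σ zero) + ΣB.∑ᶠ (λ s → g (adjoinZero σ (suc s)))
        ≈⟨ B.+-cong (B.trans (B.reflexive (signed-fixZero σ _)) (B.trans (±-cong sgn (fPerm-fixZero σ inj a)) (±-* sgn _ _)))
                    (ΣB.∑ᶠ-cong (λ s → B.trans (signed-insertZero σ s inj _) (B.-‿cong (±-cong sgn (fPerm-insertZero σ s inj a))))) ⟩
      f A.1# * x + ΣB.∑ᶠ {m} (λ _ → - x)                       ≈⟨ B.+-cong B.refl (∑ᶠ-const-neg m x) ⟩
      f A.1# * x + - (k * x)                                   ≈⟨ B.+-cong B.refl (-‿distribˡ-* k x) ⟩
      f A.1# * x + - k * x                                     ≈⟨ B.sym (B.distribʳ x _ _) ⟩
      c * x                                                    ∎
      where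
      inj = isPermᵇ⇒injective σ perm
      sgn = isEven (inversions σ)
      x = ε[ σ ] (F σ)

module _ {c ℓ} (R : CommutativeRing c ℓ) where
  open CommutativeRing R
  private
    _·1 : ℕ → Carrier
    k ·1 = _·_ {R = R} k 1#
    module G = GroupProperties (CommutativeRing.+-group R)

  fallingFactorial : Carrier → ℕ → Carrier
  fallingFactorial x zero = 1#
  fallingFactorial x (suc m) = (x - m ·1) * fallingFactorial x m

  fallingFactorial-root : IsIntegralDomain R → ∀ x m → fallingFactorial x m ≈ 0# → Σ ℕ λ k → k < m × x ≈ k ·1
  fallingFactorial-root dom x zero 1≈0 = ⊥-elim (IsIntegralDomain.1≉0 dom 1≈0)
  fallingFactorial-root dom x (suc m) eq with IsIntegralDomain.noZeroDivisors dom _ _ eq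
  ... | inj₁ x-m≈0 = m , ℕP.≤-refl , G.x∙y⁻¹≈ε⇒x≈y x (m ·1) x-m≈0
  ... | inj₂ rest≈0 with k , k<m , x≈k ← fallingFactorial-root dom x m rest≈0 = k , ℕP.m≤n⇒m≤1+n k<m , x≈k

  <⇒·1≉·1 : (∀ d → ¬ (suc d ·1 ≈ 0#)) → ∀ {k n} → k < n → ¬ (k ·1 ≈ n ·1)
  <⇒·1≉·1 charZero {k} {n} k<n k≈n = charZero d (G.identityʳ-unique (k ·1) (suc d ·1) (begin
    k ·1 + suc d ·1     ≈⟨ sym (MultProperties.×-homo-+ +-monoid 1# k (suc d)) ⟩
    (k Nat.+ suc d) ·1  ≡⟨ ≡.cong _·1 k+d+1≡n ⟩
    n ·1                ≈⟨ sym k≈n ⟩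
    k ·1                ∎))
    where
    open SetoidReasoning setoid
    d = n Nat.∸ suc k
    k+d+1≡n : k Nat.+ suc d ≡ n
    k+d+1≡n = ≡.trans (ℕP.+-suc k d) (ℕP.m+[n∸m]≡n k<n)

module _ {c ℓ c′ ℓ′} (K : CommutativeRing c ℓ) (B : CommutativeRing c′ ℓ′) where
  private
    module K = CommutativeRing K
    module B = CommutativeRing B

  charZero-transfer : IsField K → CharZero K → ∀ {ι} → IsRingHomomorphism K.rawRing B.rawRing ι →
                      ¬ (B.1# B.≈ B.0#) → ∀ d → ¬ (_·_ {R = B} (suc d) B.1# B.≈ B.0#)
  charZero-transfer isField charZero {ι} hom 1≉0 d d+1≈0 with y , [d+1]y≈1 ← IsField.inverse isField _ (charZero d) =
    1≉0 (begin
      B.1#                                 ≈⟨ B.sym 1#-homo ⟩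
      ι K.1#                               ≈⟨ ⟦⟧-cong (K.sym [d+1]y≈1) ⟩
      ι (_·_ {R = K} (suc d) K.1# K.* y)   ≈⟨ *-homo _ y ⟩
      ι (_·_ {R = K} (suc d) K.1#) B.* ι y ≈⟨ B.*-cong (B.trans (ι-·1 (suc d)) d+1≈0) B.refl ⟩
      B.0# B.* ι y                         ≈⟨ B.zeroˡ _ ⟩
      B.0#                                 ∎)
    where
    open IsRingHomomorphism hom
    open SetoidReasoning B.setoid
    ι-·1 : ∀ j → ι (_·_ {R = K} j K.1#) B.≈ _·_ {R = B} j B.1#
    ι-·1 zero = 0#-homo
    ι-·1 (suc j) = B.trans (+-homo K.1# _) (B.+-cong 1#-homo (ι-·1 j))

-- Unlike Data.Vec.Functional.replicate, this unfolds to x ∷ᶠ …, the shape Φ-cons-1 is stated for.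
replicateᶠ : ∀ {a} {X : Set a} → X → ∀ m → Fin m → X
replicateᶠ x zero = λ ()
replicateᶠ x (suc m) = x ∷ᶠ replicateᶠ x m

module _ {c₁ ℓ₁ c₂ ℓ₂} (A : CommutativeRing c₁ ℓ₁) (B : CommutativeRing c₂ ℓ₂)
         (f : CommutativeRing.Carrier A → CommutativeRing.Carrier B)
         (f-cong : ∀ {x y} → CommutativeRing._≈_ A x y → CommutativeRing._≈_ B (f x) (f y)) where
  private
    module A = CommutativeRing A
    module B = CommutativeRing B
  open PhiRecursion A B f f-cong using (Φ-cons-1)

  Φ-replicate-1 : ∀ m → Φ A B m f (replicateᶠ A.1# m) B.≈ fallingFactorial B (f A.1#) m
  Φ-replicate-1 zero = B.+-identityʳ B.1#
  Φ-replicate-1 (suc m) = B.trans (Φ-cons-1 m (replicateᶠ A.1# m)) (B.*-cong B.refl (Φ-replicate-1 m))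

  vanishesΦ-pred : IsIntegralDomain B → ∀ n → ¬ (f A.1# B.≈ _·_ {R = B} n B.1#) →
                   VanishesΦ A B (suc n) f → VanishesΦ A B n f
  vanishesΦ-pred dom n f1≉n vanishes a =
    [ (λ f1-n≈0 → ⊥-elim (f1≉n (GroupProperties.x∙y⁻¹≈ε⇒x≈y B.+-group _ _ f1-n≈0))) , id ]′
      (IsIntegralDomain.noZeroDivisors dom _ _ (B.trans (B.sym (Φ-cons-1 n a)) (vanishes (A.1# ∷ᶠ a))))

lemma2p4 : ∀ {c ℓ c₁ ℓ₁ c₂ ℓ₂ : Level}
    (K : CommutativeRing c ℓ) → IsField K → CharZero K →
    (A : CommutativeRing c₁ ℓ₁) (ιA : CommutativeRing.Carrier K → CommutativeRing.Carrier A) → IsAlgebraMap K A ιA →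
    (B : CommutativeRing c₂ ℓ₂) (ιB : CommutativeRing.Carrier K → CommutativeRing.Carrier B) → IsAlgebraMap K B ιB →
    IsIntegralDomain B →
    (f : CommutativeRing.Carrier A → CommutativeRing.Carrier B) → IsLinear K A B ιA ιB f →
    (n : ℕ) → n ≥ 1 →
    VanishesΦ A B (Data.Nat.suc n) f → ¬ VanishesΦ A B n f →
    CommutativeRing._≈_ B (f (CommutativeRing.1# A)) (_·_ {R = B} n (CommutativeRing.1# B))
lemma2p4 K isField charZero A _ _ B _ ιB-hom dom f linear n _ vanishes not-vanishes =
  root-is-n (fallingFactorial-root B dom (f A.1#) (suc n)
              (B.trans (B.sym (Φ-replicate-1 A B f f-cong (suc n))) (vanishes (replicateᶠ A.1# (suc n)))))
  where
  module A = CommutativeRing A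
  module B = CommutativeRing B
  f-cong = IsLinear.cong linear
  _·1 : ℕ → B.Carrier
  k ·1 = _·_ {R = B} k B.1#
  root-is-n : Σ ℕ (λ k → k < suc n × f A.1# B.≈ k ·1) → f A.1# B.≈ n ·1
  root-is-n (k , s≤s k≤n , f1≈k) with ℕP.m≤n⇒m<n∨m≡n k≤n
  ... | inj₂ ≡.refl = f1≈k
  ... | inj₁ k<n = ⊥-elim (not-vanishes (vanishesΦ-pred A B f f-cong dom n f1≉n vanishes))
    where
    f1≉n : ¬ (f A.1# B.≈ n ·1)
    f1≉n f1≈n = <⇒·1≉·1 B (charZero-transfer K B isField charZero ιB-hom (IsIntegralDomain.1≉0 dom)) k<n (B.trans (B.sym f1≈k) f1≈n)
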